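{- Let $A\subset\mathbb{R}^2$ be finite and not contained in a line, and let $m_A$ denote the maximal number of points of $A$ contained in a side of $[A]$. Then $$|A+A|\ \ge\ \frac{\Delta_A^2}{4}-\frac{\Delta_A(m_A-1)}{2}.$$
   Context: $[A]$ is the convex hull of $A$, and $\Delta_A$ denotes the number of points of $A$ on the boundary of $[A]$. -}

module Defs where

open import Level using (Level; _⊔_) renaming (suc to lsuc)
open import Algebra.Bundles using (CommutativeRing)
open import Relation.Binary.Core using (Rel)
open import Relation.Binary.Structures using (IsTotalOrder)
open import Relation.Nullary using (¬_)
open import Relation.Binary.PropositionalEquality using (_≡_)
open import Data.Product using (_×_; _,_; proj₁; proj₂; ∃; Σ-syntax; ∃-syntax)
open import Data.List using (List; length)
open import Data.List.Relation.Unary.Any using (Any)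
open import Data.List.Relation.Unary.All using (All)
open import Data.List.Relation.Unary.AllPairs using (AllPairs)
open import Data.Nat using (ℕ; _≤_)

-- An ordered field (classical notion; ℝ is an instance).  Decidability of
-- the order / equality is NOT assumed.
record OrderedField (c ℓ₁ ℓ₂ : Level) : Set (lsuc (c ⊔ ℓ₁ ⊔ ℓ₂)) where
  field
    commutativeRing : CommutativeRing c ℓ₁
  open CommutativeRing commutativeRing public
  field
    _≤F_          : Rel Carrier ℓ₂
    isTotalOrder  : IsTotalOrder _≈_ _≤F_
    +-mono-≤      : ∀ {x y} z → x ≤F y → (x + z) ≤F (y + z)
    *-nonneg      : ∀ {x y} → 0# ≤F x → 0# ≤F y → 0# ≤F (x * y)
    0≉1           : ¬ (0# ≈ 1#)
    inverse       : ∀ x → ¬ (x ≈ 0#) → ∃ λ y → (x * y) ≈ 1#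

module Plane {c ℓ₁ ℓ₂ : Level} (F : OrderedField c ℓ₁ ℓ₂) where
  open OrderedField F

  Point : Set c
  Point = Carrier × Carrier

  _≈ₚ_ : Point → Point → Set ℓ₁
  p ≈ₚ q = (proj₁ p ≈ proj₁ q) × (proj₂ p ≈ proj₂ q)

  _+ₚ_ : Point → Point → Point
  p +ₚ q = (proj₁ p + proj₁ q , proj₂ p + proj₂ q)

  _∈ₚ_ : Point → List Point → Set (c ⊔ ℓ₁)
  p ∈ₚ A = Any (p ≈ₚ_) A

  Distinct : List Point → Set (c ⊔ ℓ₁)
  Distinct = AllPairs (λ p q → ¬ (p ≈ₚ q))

  lin : Carrier → Carrier → Point → Carrier
  lin u v p = u * proj₁ p + v * proj₂ p

  NonZeroDir : Carrier → Carrier → Set ℓ₁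
  NonZeroDir u v = ¬ ((u ≈ 0#) × (v ≈ 0#))

  Collinear : List Point → Set (c ⊔ ℓ₁)
  Collinear A = ∃[ u ] ∃[ v ] ∃[ k ] (NonZeroDir u v × All (λ p → lin u v p ≈ k) A)

  IsSupporting : List Point → Carrier → Carrier → Carrier → Set (c ⊔ ℓ₁ ⊔ ℓ₂)
  IsSupporting A u v k = NonZeroDir u v × All (λ p → lin u v p ≤F k) A

  -- p lies on the boundary of the convex hull [A]  (A finite, spanning the plane):
  -- p lies on some supporting line of [A]
  OnBoundary : List Point → Point → Set (c ⊔ ℓ₁ ⊔ ℓ₂)
  OnBoundary A p = ∃[ u ] ∃[ v ] ∃[ k ] (IsSupporting A u v k × (lin u v p ≈ k))

  CardIs : ∀ {ℓ} → (Point → Set ℓ) → ℕ → Set (c ⊔ ℓ₁ ⊔ ℓ)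
  CardIs P n = Σ[ B ∈ List Point ]
    (Distinct B × (∀ p → p ∈ₚ B → P p) × (∀ p → P p → p ∈ₚ B) × (length B ≡ n))

  SumsetSize : List Point → ℕ → Set (c ⊔ ℓ₁)
  SumsetSize A s = CardIs (λ p → ∃[ a ] ∃[ b ] (a ∈ₚ A × b ∈ₚ A × (p ≈ₚ (a +ₚ b)))) s

  BoundaryCount : List Point → ℕ → Set (c ⊔ ℓ₁ ⊔ ℓ₂)
  BoundaryCount A d = CardIs (λ p → p ∈ₚ A × OnBoundary A p) d

  -- some side (edge) of [A] contains exactly k points of A: the side is the
  -- intersection of [A] with a supporting line meeting A in at least 2 points
  SideSize : List Point → ℕ → Set (c ⊔ ℓ₁ ⊔ ℓ₂)
  SideSize A k = ∃[ u ] ∃[ v ] ∃[ w ]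
    (IsSupporting A u v w × CardIs (λ p → p ∈ₚ A × (lin u v p ≈ w)) k × (2 ≤ k))

  MaxSideSize : List Point → ℕ → Set (c ⊔ ℓ₁ ⊔ ℓ₂)
  MaxSideSize A m = SideSize A m × (∀ k → SideSize A k → k ≤ m)

-- Take a diameter pq of A and let G be the coordinate along q - p: then p and q are the unique
-- G-minimum and G-maximum of A, and every other boundary point lies on a supporting line facing
-- one side of the line pq. This splits the Δ_A boundary points into an upper and a lower arc from
-- p to q, each strictly increasing in G. For such an arc z 0, …, z K, a sum z i + z j can equal
-- z i′ + z j′ with i < i′ ≤ j′ < j only if z i, …, z j lie on one side of [A]. Hence the sums
-- z i + z (K + 1) that are already present when z (K + 1) is added come from the straight run of
-- points that precedes it on one side, and since a side carries at most m_A points, an induction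
-- that also tracks the current run gives (K + 1)(K + 2) ≤ 2 |S| + K (m_A - 2) for the set S of
-- sums of the arc. An upper and a lower sum can coincide only in 2p, p + q or 2q, unless A lies on
-- the line pq; adding the two bounds, with K_upper + K_lower = Δ_A, gives the inequality.
-- The argument is classical: it runs in the double-negation monad, and the decidable conclusion
-- is recovered at the end.

module Submission where

open import Level using (Level; _⊔_)
open import Algebra.Bundles using (CommutativeRing)
open import Relation.Binary.Bundles using (Setoid; TotalOrder)
open import Data.Nat using (ℕ)
open import Defs
open import Data.List using (List)
open import Relation.Nullary using (¬_)

-- Integer coefficients let the ring solver cancel terms such as x - x, which it cannot do when the
-- coefficients are taken from R itself, whose equality is not decidable.
module IntegerCoefficientSolver {c ℓ} (R : CommutativeRing c ℓ) where

  open CommutativeRing R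
  open import Algebra.Properties.Ring ring using (-‿involutive; -0#≈0#; -‿+-comm; -1*x≈-x)
  open import Algebra.Properties.CommutativeSemigroup *-commutativeSemigroup
    using () renaming (interchange to *-interchange)
  open import Algebra.Properties.CommutativeSemigroup +-commutativeSemigroup
    using () renaming (interchange to +-interchange)
  open import Algebra.Properties.Semiring.Mult semiring using (_×_; ×-homo-+; ×1-homo-*)
  open import Algebra.Solver.Ring.AlmostCommutativeRing
    using (fromCommutativeRing; _-Raw-AlmostCommutative⟶_)
  open import Relation.Binary.Reasoning.Setoid setoid
  open import Data.Integer.Base as ℤ using (ℤ; +_; -[1+_]; _⊖_; _◃_; sign; ∣_∣)
  import Data.Integer.Properties as ℤ
  open import Data.Nat.Base as ℕ using (zero; suc)
  open import Data.Sign.Base as Sign using (Sign)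
  open import Data.Maybe.Base using (Maybe; just; nothing)
  open import Relation.Nullary using (yes; no)
  import Relation.Binary.PropositionalEquality as ≡

  ⟦_⟧ℤ : ℤ → Carrier
  ⟦ + n ⟧ℤ = n × 1#
  ⟦ -[1+ n ] ⟧ℤ = - (suc n × 1#)

  private
    ⟦_⟧ₛ : Sign → Carrier
    ⟦ Sign.+ ⟧ₛ = 1#
    ⟦ Sign.- ⟧ₛ = - 1#

    ⟦◃⟧ : ∀ s n → ⟦ s ◃ n ⟧ℤ ≈ ⟦ s ⟧ₛ * (n × 1#)
    ⟦◃⟧ s zero = sym (zeroʳ _)
    ⟦◃⟧ Sign.+ (suc n) = sym (*-identityˡ _)
    ⟦◃⟧ Sign.- (suc n) = sym (-1*x≈-x _)

    ⟦sign⟧-* : ∀ s t → ⟦ s Sign.* t ⟧ₛ ≈ ⟦ s ⟧ₛ * ⟦ t ⟧ₛ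
    ⟦sign⟧-* Sign.+ t = sym (*-identityˡ _)
    ⟦sign⟧-* Sign.- Sign.+ = sym (*-identityʳ _)
    ⟦sign⟧-* Sign.- Sign.- = sym (trans (-1*x≈-x _) (-‿involutive _))

    ⟦⟧-sign-abs : ∀ i → ⟦ i ⟧ℤ ≈ ⟦ sign i ⟧ₛ * (∣ i ∣ × 1#)
    ⟦⟧-sign-abs i = trans (reflexive (≡.cong ⟦_⟧ℤ (≡.sym (ℤ.◃-inverse i)))) (⟦◃⟧ (sign i) ∣ i ∣)

    ⟦⟧-* : ∀ i j → ⟦ i ℤ.* j ⟧ℤ ≈ ⟦ i ⟧ℤ * ⟦ j ⟧ℤ
    ⟦⟧-* i j = begin
      ⟦ (sign i Sign.* sign j) ◃ (∣ i ∣ ℕ.* ∣ j ∣) ⟧ℤ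
        ≈⟨ ⟦◃⟧ (sign i Sign.* sign j) (∣ i ∣ ℕ.* ∣ j ∣) ⟩
      ⟦ sign i Sign.* sign j ⟧ₛ * ((∣ i ∣ ℕ.* ∣ j ∣) × 1#)
        ≈⟨ *-cong (⟦sign⟧-* (sign i) (sign j)) (×1-homo-* ∣ i ∣ ∣ j ∣) ⟩
      (⟦ sign i ⟧ₛ * ⟦ sign j ⟧ₛ) * ((∣ i ∣ × 1#) * (∣ j ∣ × 1#))
        ≈⟨ *-interchange ⟦ sign i ⟧ₛ ⟦ sign j ⟧ₛ (∣ i ∣ × 1#) (∣ j ∣ × 1#) ⟩
      (⟦ sign i ⟧ₛ * (∣ i ∣ × 1#)) * (⟦ sign j ⟧ₛ * (∣ j ∣ × 1#))
        ≈⟨ sym (*-cong (⟦⟧-sign-abs i) (⟦⟧-sign-abs j)) ⟩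
      ⟦ i ⟧ℤ * ⟦ j ⟧ℤ ∎

    ⟦⊖⟧ : ∀ m n → ⟦ m ⊖ n ⟧ℤ ≈ m × 1# - n × 1#
    ⟦⊖⟧ m zero = sym (trans (+-congˡ -0#≈0#) (+-identityʳ _))
    ⟦⊖⟧ zero (suc n) = sym (+-identityˡ _)
    ⟦⊖⟧ (suc m) (suc n) = begin
      ⟦ suc m ⊖ suc n ⟧ℤ                  ≈⟨ reflexive (≡.cong ⟦_⟧ℤ (ℤ.[1+m]⊖[1+n]≡m⊖n m n)) ⟩
      ⟦ m ⊖ n ⟧ℤ                          ≈⟨ ⟦⊖⟧ m n ⟩
      x - y                               ≈⟨ sym (+-identityˡ _) ⟩
      0# + (x - y)                        ≈⟨ +-congʳ (sym (-‿inverseʳ 1#)) ⟩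
      (1# - 1#) + (x - y)                 ≈⟨ +-assoc _ _ _ ⟩
      1# + (- 1# + (x - y))               ≈⟨ +-congˡ (sym (+-assoc _ _ _)) ⟩
      1# + ((- 1# + x) - y)               ≈⟨ +-congˡ (+-congʳ (+-comm _ _)) ⟩
      1# + ((x - 1#) - y)                 ≈⟨ +-congˡ (+-assoc _ _ _) ⟩
      1# + (x + (- 1# - y))               ≈⟨ sym (+-assoc _ _ _) ⟩
      (1# + x) + (- 1# - y)               ≈⟨ +-congˡ (-‿+-comm _ _) ⟩
      (1# + x) - (1# + y)                 ∎
      where x = m × 1#; y = n × 1#

    ⟦⟧-+ : ∀ i j → ⟦ i ℤ.+ j ⟧ℤ ≈ ⟦ i ⟧ℤ + ⟦ j ⟧ℤ
    ⟦⟧-+ -[1+ m ] -[1+ n ] = begin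
      - (1# + (1# + (m ℕ.+ n) × 1#))         ≈⟨ -‿cong (+-congˡ (+-congˡ (×-homo-+ 1# m n))) ⟩
      - (1# + (1# + (m × 1# + n × 1#)))      ≈⟨ -‿cong (sym (+-assoc _ _ _)) ⟩
      - ((1# + 1#) + (m × 1# + n × 1#))      ≈⟨ -‿cong (+-interchange _ _ _ _) ⟩
      - ((1# + m × 1#) + (1# + n × 1#))      ≈⟨ sym (-‿+-comm _ _) ⟩
      - (1# + m × 1#) - (1# + n × 1#)        ∎
    ⟦⟧-+ -[1+ m ] (+ n) = trans (⟦⊖⟧ n (suc m)) (+-comm _ _)
    ⟦⟧-+ (+ m) -[1+ n ] = ⟦⊖⟧ m (suc n)
    ⟦⟧-+ (+ m) (+ n) = ×-homo-+ 1# m n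

    ⟦⟧-neg : ∀ i → ⟦ ℤ.- i ⟧ℤ ≈ - ⟦ i ⟧ℤ
    ⟦⟧-neg -[1+ n ] = sym (-‿involutive _)
    ⟦⟧-neg (+ zero) = sym -0#≈0#
    ⟦⟧-neg (+ suc n) = refl

    homomorphism : ℤ.+-*-rawRing -Raw-AlmostCommutative⟶ fromCommutativeRing R
    homomorphism = record
      { ⟦_⟧ = ⟦_⟧ℤ
      ; +-homo = ⟦⟧-+
      ; *-homo = ⟦⟧-*
      ; -‿homo = ⟦⟧-neg
      ; 0-homo = refl
      ; 1-homo = +-identityʳ 1#
      }

    _≟ℤ_ : ∀ i j → Maybe (⟦ i ⟧ℤ ≈ ⟦ j ⟧ℤ)
    i ≟ℤ j with i ℤ.≟ j
    ... | yes ≡.refl = just refl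
    ... | no _ = nothing

  open import Algebra.Solver.Ring ℤ.+-*-rawRing (fromCommutativeRing R) homomorphism _≟ℤ_ public

module Classical where

  open import Data.Product using (_×_; _,_)
  open import Data.List using (List; []; _∷_)
  open import Data.List.Relation.Unary.All as All using (All; []; _∷_)
  open import Data.List.Membership.Propositional using (_∈_)
  open import Relation.Nullary using (¬_; Dec; yes; no)
  open import Data.Sum using (_⊎_; inj₁; inj₂)
  open import Relation.Nullary.Decidable using (¬¬-excluded-middle)

  private
    variable
      a b p : Level
      A B : Set a

  -- The double-negation monad of the standard library is not universe polymorphic in its bind.
  infixl 1 _>>=_
  _>>=_ : ¬ ¬ A → (A → ¬ ¬ B) → ¬ ¬ B
  (m >>= f) k = m (λ x → f x k)

  return : A → ¬ ¬ A
  return x k = k x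

  ¬¬-decide : (P : Set a) → ¬ ¬ Dec P
  ¬¬-decide P = ¬¬-excluded-middle

  ¬¬-de-morgan : ∀ {P : Set a} {Q : Set b} → ¬ (P × Q) → ¬ ¬ (¬ P ⊎ ¬ Q)
  ¬¬-de-morgan ¬pq = do
    yes p ← ¬¬-excluded-middle
      where no ¬p → return (inj₁ ¬p)
    return (inj₂ (λ q → ¬pq (p , q)))

  ¬¬-sequence : ∀ {P : A → Set p} {xs} → All (λ x → ¬ ¬ P x) xs → ¬ ¬ All P xs
  ¬¬-sequence [] = return []
  ¬¬-sequence (¬¬px ∷ ¬¬pxs) = do
    px ← ¬¬px
    pxs ← ¬¬-sequence ¬¬pxs
    return (px ∷ pxs)

  ¬¬-all : ∀ {P : A → Set p} (xs : List A) → (∀ x → x ∈ xs → ¬ ¬ P x) → ¬ ¬ All P xs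
  ¬¬-all xs f = ¬¬-sequence (All.tabulate (λ {x} → f x))

  ¬¬-decide-all : ∀ {P : A → Set p} (xs : List A) → ¬ ¬ All (λ x → Dec (P x)) xs
  ¬¬-decide-all xs = ¬¬-all xs (λ _ _ → ¬¬-excluded-middle)

module Selection {a p} {X : Set a} {P : X → Set p} where

  open import Data.Empty using (⊥-elim)
  open import Data.Product using (_×_; _,_)
  open import Data.List using (List; []; _∷_; length)
  open import Data.List.Relation.Unary.Any using (Any; here; there)
  open import Data.List.Relation.Unary.All using (All; []; _∷_)
  open import Data.List.Relation.Unary.AllPairs using (AllPairs; []; _∷_)
  open import Data.Nat using (suc; _+_)
  open import Data.Nat.Properties using (+-suc)
  open import Relation.Nullary using (¬_; Dec; yes; no)
  open import Relation.Binary.PropositionalEquality using (_≡_; refl; cong; trans)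

  Decisions : List X → Set (a ⊔ p)
  Decisions = All (λ x → Dec (P x))

  accepted rejected : {xs : List X} → Decisions xs → List X
  accepted [] = []
  accepted {x ∷ _} (yes _ ∷ ds) = x ∷ accepted ds
  accepted (no _ ∷ ds) = accepted ds
  rejected [] = []
  rejected (yes _ ∷ ds) = rejected ds
  rejected {x ∷ _} (no _ ∷ ds) = x ∷ rejected ds

  length-accepted+rejected : ∀ {xs} (ds : Decisions xs) → length (accepted ds) + length (rejected ds) ≡ length xs
  length-accepted+rejected [] = refl
  length-accepted+rejected (yes _ ∷ ds) = cong suc (length-accepted+rejected ds)
  length-accepted+rejected (no _ ∷ ds) =
    trans (+-suc (length (accepted ds)) (length (rejected ds))) (cong suc (length-accepted+rejected ds))

  accepted-All : ∀ {xs} (ds : Decisions xs) → All P (accepted ds)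
  accepted-All [] = []
  accepted-All (yes px ∷ ds) = px ∷ accepted-All ds
  accepted-All (no _ ∷ ds) = accepted-All ds

  rejected-All : ∀ {xs} (ds : Decisions xs) → All (λ x → ¬ P x) (rejected ds)
  rejected-All [] = []
  rejected-All (yes _ ∷ ds) = rejected-All ds
  rejected-All (no ¬px ∷ ds) = ¬px ∷ rejected-All ds

  module _ {q} {Q : X → Set q} where

    accepted⁺ : ∀ {xs} (ds : Decisions xs) → All Q xs → All Q (accepted ds)
    accepted⁺ [] [] = []
    accepted⁺ (yes _ ∷ ds) (qx ∷ qxs) = qx ∷ accepted⁺ ds qxs
    accepted⁺ (no _ ∷ ds) (_ ∷ qxs) = accepted⁺ ds qxs

    rejected⁺ : ∀ {xs} (ds : Decisions xs) → All Q xs → All Q (rejected ds)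
    rejected⁺ [] [] = []
    rejected⁺ (yes _ ∷ ds) (_ ∷ qxs) = rejected⁺ ds qxs
    rejected⁺ (no _ ∷ ds) (qx ∷ qxs) = qx ∷ rejected⁺ ds qxs

    accepted-Any : ∀ {xs} (ds : Decisions xs) → Any (λ x → Q x × P x) xs → Any Q (accepted ds)
    accepted-Any (yes _ ∷ ds) (here (qx , _)) = here qx
    accepted-Any (no ¬px ∷ ds) (here (_ , px)) = ⊥-elim (¬px px)
    accepted-Any (yes _ ∷ ds) (there any) = there (accepted-Any ds any)
    accepted-Any (no _ ∷ ds) (there any) = accepted-Any ds any

  module _ {r} {R : X → X → Set r} where

    accepted-AllPairs : ∀ {xs} (ds : Decisions xs) → AllPairs R xs → AllPairs R (accepted ds)
    accepted-AllPairs [] [] = []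
    accepted-AllPairs (yes _ ∷ ds) (rx ∷ rxs) = accepted⁺ ds rx ∷ accepted-AllPairs ds rxs
    accepted-AllPairs (no _ ∷ ds) (_ ∷ rxs) = accepted-AllPairs ds rxs

    rejected-AllPairs : ∀ {xs} (ds : Decisions xs) → AllPairs R xs → AllPairs R (rejected ds)
    rejected-AllPairs [] [] = []
    rejected-AllPairs (yes _ ∷ ds) (_ ∷ rxs) = rejected-AllPairs ds rxs
    rejected-AllPairs (no _ ∷ ds) (rx ∷ rxs) = rejected⁺ ds rx ∷ rejected-AllPairs ds rxs

module SetoidPigeonhole {a ℓ} (S : Setoid a ℓ) where

  open import Data.Product using (_,_)
  open Setoid S
  open Classical
  import Data.Nat.Properties as ℕ
  open import Data.List using (_++_)
  open import Data.List.Properties using (length-++)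
  import Data.List.Relation.Unary.AllPairs.Properties as AllPairs
  import Data.List.Relation.Unary.All.Properties as AllProp
  open import Data.List.Membership.Setoid.Properties using (∈-resp-≈)
  open import Data.List using (List; []; _∷_; length)
  open import Data.List.Properties using (length-removeAt′)
  open import Data.List.Relation.Unary.Any as Any using (here; there; _─_)
  open import Data.List.Relation.Unary.All as All using (All; []; _∷_)
  open import Data.List.Relation.Unary.Unique.Setoid S using (Unique; []; _∷_)
  open import Data.List.Membership.Setoid S using (_∈_)
  open import Data.Nat using (_+_; _≤_; z≤n; s≤s)
  open import Relation.Nullary using (¬_; contradiction)
  open import Relation.Binary.PropositionalEquality as ≡ using (subst)

  private
    ∈-─ : ∀ {x y ys} → x ∈ ys → ¬ x ≈ y → (y∈ys : y ∈ ys) → x ∈ (ys ─ y∈ys)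
    ∈-─ (here x≈z) x≉y (here y≈z) = contradiction (trans x≈z (sym y≈z)) x≉y
    ∈-─ (there x∈ys) x≉y (here y≈z) = x∈ys
    ∈-─ (here x≈z) x≉y (there y∈ys) = here x≈z
    ∈-─ (there x∈ys) x≉y (there y∈ys) = there (∈-─ x∈ys x≉y y∈ys)

  Unique∧⊆⇒length≤ : ∀ {xs ys} → Unique xs → All (_∈ ys) xs → length xs ≤ length ys
  Unique∧⊆⇒length≤ [] [] = z≤n
  Unique∧⊆⇒length≤ {ys = ys} (x≉xs ∷ xs!) (x∈ys ∷ xs⊆ys) =
    subst (_ ≤_) (≡.sym (length-removeAt′ ys (Any.index x∈ys)))
      (s≤s (Unique∧⊆⇒length≤ xs!
        (All.zipWith (λ (z∈ys , x≉z) → ∈-─ z∈ys (λ z≈x → x≉z (sym z≈x)) x∈ys) (xs⊆ys , x≉xs))))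

  ¬¬-union-bound : ∀ {xs ys zs ws} → Unique xs → Unique ys → All (_∈ zs) xs → All (_∈ zs) ys →
    All (λ y → y ∈ xs → ¬ ¬ (y ∈ ws)) ys → ¬ ¬ (length xs + length ys ≤ length zs + length ws)
  ¬¬-union-bound {xs} {ys} {zs} {ws} xs! ys! xs⊆zs ys⊆zs common⊆ws = do
    ds ← ¬¬-decide-all ys
    accepted⊆ws ← ¬¬-sequence (All.zipWith (λ (⊆ws , y∈xs) → ⊆ws y∈xs) (accepted⁺ ds common⊆ws , accepted-All ds))
    return (split-bound ds accepted⊆ws)
    where
    open Selection {P = _∈ xs}
    split-bound : (ds : Decisions ys) → All (_∈ ws) (accepted ds) → length xs + length ys ≤ length zs + length ws
    split-bound ds common⊆ws = begin
      length xs + length ys                     ≡⟨ ≡.cong (length xs +_) (≡.sym (length-accepted+rejected ds)) ⟩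
      length xs + (length common + length rest) ≡⟨ ≡.cong (length xs +_) (ℕ.+-comm (length common) _) ⟩
      length xs + (length rest + length common) ≡⟨ ≡.sym (ℕ.+-assoc (length xs) _ _) ⟩
      length xs + length rest + length common   ≡⟨ ≡.cong (_+ length common) (≡.sym (length-++ xs)) ⟩
      length (xs ++ rest) + length common       ≤⟨ ℕ.+-mono-≤
                                                     (Unique∧⊆⇒length≤ xs++rest! (AllProp.++⁺ xs⊆zs (rejected⁺ ds ys⊆zs)))
                                                     (Unique∧⊆⇒length≤ (accepted-AllPairs ds ys!) common⊆ws) ⟩
      length zs + length ws                     ∎
      where
      open ℕ.≤-Reasoning
      common rest : List Carrier
      common = accepted ds
      rest = rejected ds
      xs++rest! : Unique (xs ++ rest)
      xs++rest! = AllPairs.++⁺ xs! (rejected-AllPairs ds ys!)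
        (All.tabulate (λ x∈xs → All.map (λ y∉xs x≈y → y∉xs (∈-resp-≈ S x≈y (Any.map (λ { ≡.refl → refl }) x∈xs)))
                                         (rejected-All ds)))

module IndexCounting {p} {P : ℕ → Set p} where

  open import Data.Product using (_×_; _,_)
  open import Data.Nat using (_+_; _∸_; _≤_; _<_)
  open import Data.List using (upTo; applyUpTo; length)
  open import Data.List.Properties using (length-applyUpTo; length-upTo)
  open import Data.List.Relation.Unary.All as All using (All)
  import Data.List.Relation.Unary.Unique.Propositional.Properties as Unique
  open import Data.List.Membership.Propositional using (_∈_)
  open import Data.List.Membership.Propositional.Properties using (∈-upTo⁻; ∈-applyUpTo⁺)
  open import Data.Nat.Properties
  open import Relation.Nullary using (¬_)
  open import Relation.Binary.PropositionalEquality as ≡ using (_≡_; subst)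
  open Selection {P = P}
  open SetoidPigeonhole (≡.setoid ℕ) using (Unique∧⊆⇒length≤)

  private
    ∈-interval : ∀ {lo c i} → lo ≤ i → i < lo + c → i ∈ applyUpTo (lo +_) c
    ∈-interval {lo} {c} {i} lo≤i i<lo+c =
      subst (_∈ applyUpTo (lo +_) c) (m+[n∸m]≡n lo≤i)
        (∈-applyUpTo⁺ (lo +_) (+-cancelˡ-< lo (i ∸ lo) c (subst (_< lo + c) (≡.sym (m+[n∸m]≡n lo≤i)) i<lo+c)))

  length-accepted-upTo : ∀ n lo c (ds : Decisions (upTo n)) →
    (∀ i → i < n → ¬ P i → lo ≤ i × i < lo + c) → n ≤ length (accepted ds) + c
  length-accepted-upTo n lo c ds rejected-in-interval = begin
    n                                               ≡⟨ ≡.sym (length-upTo n) ⟩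
    length (upTo n)                                 ≡⟨ ≡.sym (length-accepted+rejected ds) ⟩
    length (accepted ds) + length (rejected ds)     ≤⟨ +-monoʳ-≤ (length (accepted ds)) rejected≤c ⟩
    length (accepted ds) + c                        ∎
    where
    open ≤-Reasoning
    rejected≤c : length (rejected ds) ≤ c
    rejected≤c = subst (length (rejected ds) ≤_) (length-applyUpTo (lo +_) c)
      (Unique∧⊆⇒length≤ (rejected-AllPairs ds (Unique.upTo⁺ n))
        (All.zipWith (λ (i<n , ¬Pi) → let (lo≤i , i<lo+c) = rejected-in-interval _ i<n ¬Pi in ∈-interval lo≤i i<lo+c)
          (rejected⁺ ds (All.tabulate ∈-upTo⁻) , rejected-All ds)))

module InsertionSortOn {a b ℓ₁ ℓ₂} {X : Set a} (O : TotalOrder b ℓ₁ ℓ₂) (key : X → TotalOrder.Carrier O) where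

  open TotalOrder O using (total) renaming (_≤_ to _≤ₒ_; trans to ≤ₒ-trans)
  open import Data.Sum using (inj₁; inj₂)
  open import Data.List using (List; []; _∷_; length)
  open import Data.List.Relation.Unary.All as All using (All; []; _∷_)
  open import Data.List.Relation.Unary.AllPairs using (AllPairs; []; _∷_)
  open import Relation.Binary.PropositionalEquality using (_≡_; refl; cong; trans)
  open import Data.Nat using (suc)

  insert : X → List X → List X
  insert x [] = x ∷ []
  insert x (y ∷ ys) with total (key x) (key y)
  ... | inj₁ _ = x ∷ y ∷ ys
  ... | inj₂ _ = y ∷ insert x ys

  sort : List X → List X
  sort [] = []
  sort (x ∷ xs) = insert x (sort xs)

  length-insert : ∀ x ys → length (insert x ys) ≡ suc (length ys)
  length-insert x [] = refl
  length-insert x (y ∷ ys) with total (key x) (key y)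
  ... | inj₁ _ = refl
  ... | inj₂ _ = cong suc (length-insert x ys)

  length-sort : ∀ xs → length (sort xs) ≡ length xs
  length-sort [] = refl
  length-sort (x ∷ xs) = trans (length-insert x (sort xs)) (cong suc (length-sort xs))

  module _ {p} {P : X → Set p} where

    insert⁺ : ∀ {x ys} → P x → All P ys → All P (insert x ys)
    insert⁺ {x} {[]} px [] = px ∷ []
    insert⁺ {x} {y ∷ ys} px (py ∷ pys) with total (key x) (key y)
    ... | inj₁ _ = px ∷ py ∷ pys
    ... | inj₂ _ = py ∷ insert⁺ px pys

    sort⁺ : ∀ {xs} → All P xs → All P (sort xs)
    sort⁺ [] = []
    sort⁺ (px ∷ pxs) = insert⁺ px (sort⁺ pxs)

  module _ {r} {R : X → X → Set r} (sym : ∀ {x y} → R x y → R y x) where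

    insert-AllPairs : ∀ {x ys} → All (R x) ys → AllPairs R ys → AllPairs R (insert x ys)
    insert-AllPairs {x} {[]} [] [] = [] ∷ []
    insert-AllPairs {x} {y ∷ ys} (rxy ∷ rxys) (ry ∷ rys) with total (key x) (key y)
    ... | inj₁ _ = (rxy ∷ rxys) ∷ ry ∷ rys
    ... | inj₂ _ = insert⁺ (sym rxy) ry ∷ insert-AllPairs rxys rys

    sort-AllPairs : ∀ {xs} → AllPairs R xs → AllPairs R (sort xs)
    sort-AllPairs [] = []
    sort-AllPairs {x ∷ xs} (rx ∷ rxs) = insert-AllPairs (sort⁺ rx) (sort-AllPairs rxs)

  Sorted : List X → Set (a ⊔ ℓ₂)
  Sorted = AllPairs (λ x y → key x ≤ₒ key y)

  insert-sorted : ∀ x {ys} → Sorted ys → Sorted (insert x ys)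
  insert-sorted x {[]} [] = [] ∷ []
  insert-sorted x {y ∷ ys} (y≤ys ∷ sorted) with total (key x) (key y)
  ... | inj₁ x≤y = (x≤y ∷ All.map (≤ₒ-trans x≤y) y≤ys) ∷ y≤ys ∷ sorted
  ... | inj₂ y≤x = insert⁺ y≤x y≤ys ∷ insert-sorted x sorted

  sort-sorted : ∀ xs → Sorted (sort xs)
  sort-sorted [] = []
  sort-sorted (x ∷ xs) = insert-sorted x (sort-sorted xs)

module ListExtras {a} {X : Set a} where

  open import Data.Product using (_×_; _,_)
  open import Data.List using (List; []; _∷_; length)
  open import Data.List.Relation.Unary.All as All using (All; []; _∷_)
  open import Data.List.Relation.Unary.AllPairs using (AllPairs; []; _∷_)
  open import Data.Nat using (zero; suc; _<_; s≤s)

  All⇒AllPairs : ∀ {q} {Q : X → Set q} {xs} → All Q xs → AllPairs (λ x y → Q x × Q y) xs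
  All⇒AllPairs [] = []
  All⇒AllPairs (qx ∷ qxs) = All.map (qx ,_) qxs ∷ All⇒AllPairs qxs

  lookupOr : X → List X → ℕ → X
  lookupOr default [] _ = default
  lookupOr _ (x ∷ xs) zero = x
  lookupOr default (x ∷ xs) (suc i) = lookupOr default xs i

  module _ {default : X} where

    All-lookupOr : ∀ {p} {P : X → Set p} {xs i} → All P xs → i < length xs → P (lookupOr default xs i)
    All-lookupOr {i = zero} (px ∷ _) _ = px
    All-lookupOr {i = suc i} (_ ∷ pxs) (s≤s i<n) = All-lookupOr pxs i<n

    AllPairs-lookupOr : ∀ {r} {R : X → X → Set r} {xs i j} → AllPairs R xs → i < j → j < length xs →
      R (lookupOr default xs i) (lookupOr default xs j)
    AllPairs-lookupOr {i = zero} {suc j} (rx ∷ _) _ (s≤s j<n) = All-lookupOr rx j<n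
    AllPairs-lookupOr {i = suc i} {suc j} (_ ∷ rxs) (s≤s i<j) (s≤s j<n) = AllPairs-lookupOr rxs i<j j<n

module CountingArithmetic where

  open import Data.Nat using (suc; _+_; _*_; _∸_; _≤_)
  open import Data.Nat.Properties
  open import Data.Sum using (inj₁; inj₂)
  open import Relation.Binary.PropositionalEquality using (_≡_; refl; sym; trans; cong; subst; subst₂)
  open import Data.Nat.Solver using (module +-*-Solver)
  open +-*-Solver using (solve; _:+_; _:*_; _:=_; con)

  -- The step of the invariant of ChainSums.SumCount when the straight run z start … z K grows by one point.
  invariant-extend : ∀ K r t m₀ S new → r + suc (suc t) ≡ suc (suc m₀) →
    suc K * suc (suc K) + r * suc t ≤ 2 * S + K * m₀ →
    suc (suc K) ≤ new + r →
    suc (suc K) * suc (suc (suc K)) + suc r * t ≤ 2 * (S + new) + suc K * m₀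
  invariant-extend K r t m₀ S new r+t+2≡m₀+2 inv new≥ =
    +-cancelʳ-≤ r _ _ (subst₂ _≤_ (sym lhs) (sym rhs) (+-monoˡ-≤ t (+-mono-≤ inv (*-monoʳ-≤ 2 new≥))))
    where
    m₀≡r+t : m₀ ≡ r + t
    m₀≡r+t = suc-injective (suc-injective (trans (sym r+t+2≡m₀+2) (trans (+-suc r (suc t)) (cong suc (+-suc r t)))))
    lhs : suc (suc K) * suc (suc (suc K)) + suc r * t + r ≡ suc K * suc (suc K) + r * suc t + 2 * suc (suc K) + t
    lhs = solve 3 (λ K r t → (con 2 :+ K) :* (con 3 :+ K) :+ (con 1 :+ r) :* t :+ r
                            := (con 1 :+ K) :* (con 2 :+ K) :+ r :* (con 1 :+ t) :+ con 2 :* (con 2 :+ K) :+ t) refl K r t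
    rhs : 2 * (S + new) + suc K * m₀ + r ≡ 2 * S + K * m₀ + 2 * (new + r) + t
    rhs rewrite m₀≡r+t = solve 5 (λ K r t S new → con 2 :* (S :+ new) :+ (con 1 :+ K) :* (r :+ t) :+ r
                                  := con 2 :* S :+ K :* (r :+ t) :+ con 2 :* (new :+ r) :+ t) refl K r t S new

  -- The step of the same invariant when a new straight run starts, with new reserve r′ t′ ≤ m₀.
  invariant-restart : ∀ K r t m₀ S new r′ t′ →
    suc K * suc (suc K) + r * t ≤ 2 * S + K * m₀ →
    suc (suc K) ≤ new →
    r′ * t′ ≤ m₀ →
    suc (suc K) * suc (suc (suc K)) + r′ * t′ ≤ 2 * (S + new) + suc K * m₀
  invariant-restart K r t m₀ S new r′ t′ inv new≥ r′t′≤m₀ =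
    subst₂ _≤_ (sym lhs) (sym rhs) (+-mono-≤ (+-mono-≤ (≤-trans (m≤m+n _ (r * t)) inv) (*-monoʳ-≤ 2 new≥)) r′t′≤m₀)
    where
    lhs : suc (suc K) * suc (suc (suc K)) + r′ * t′ ≡ suc K * suc (suc K) + 2 * suc (suc K) + r′ * t′
    lhs = solve 2 (λ K x → (con 2 :+ K) :* (con 3 :+ K) :+ x := (con 1 :+ K) :* (con 2 :+ K) :+ con 2 :* (con 2 :+ K) :+ x)
            refl K (r′ * t′)
    rhs : 2 * (S + new) + suc K * m₀ ≡ 2 * S + K * m₀ + 2 * new + m₀
    rhs = solve 4 (λ K m₀ S new → con 2 :* (S :+ new) :+ (con 1 :+ K) :* m₀ := con 2 :* S :+ K :* m₀ :+ con 2 :* new :+ m₀)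
            refl K m₀ S new

  square-of-sum≤ : ∀ a b → (a + b) * (a + b) ≤ 2 * (a * a) + 2 * (b * b)
  square-of-sum≤ a b with ≤-total a b
  ... | inj₁ a≤b = subst (λ b → (a + b) * (a + b) ≤ 2 * (a * a) + 2 * (b * b)) (m+[n∸m]≡n a≤b)
          (subst₂ _≤_ refl (solve 2 (λ a d → (a :+ (a :+ d)) :* (a :+ (a :+ d)) :+ d :* d
                                            := con 2 :* (a :* a) :+ con 2 :* ((a :+ d) :* (a :+ d))) refl a (b ∸ a))
                   (m≤m+n _ _))
  ... | inj₂ b≤a = subst (λ a → (a + b) * (a + b) ≤ 2 * (a * a) + 2 * (b * b)) (m+[n∸m]≡n b≤a)
          (subst₂ _≤_ refl (solve 2 (λ b d → ((b :+ d) :+ b) :* ((b :+ d) :+ b) :+ d :* d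
                                            := con 2 :* ((b :+ d) :* (b :+ d)) :+ con 2 :* (b :* b)) refl b (a ∸ b))
                   (m≤m+n _ _))

  two-chains-bound : ∀ a b m₀ s u l →
    suc a * suc (suc a) ≤ 2 * u + a * m₀ →
    suc b * suc (suc b) ≤ 2 * l + b * m₀ →
    u + l ≤ s + 3 →
    1 ≤ a + b →
    (a + b) * (a + b) ≤ 4 * s + 2 * (a + b) * (suc (suc m₀) ∸ 1)
  two-chains-bound a b m₀ s u l upper lower u+l≤s+3 1≤d = +-cancelʳ-≤ (6 * d + 8) _ _ (begin
    d * d + (6 * d + 8)                              ≤⟨ +-monoˡ-≤ (6 * d + 8) (square-of-sum≤ a b) ⟩
    2 * (a * a) + 2 * (b * b) + (6 * d + 8)          ≡⟨ solve 2 (λ a b →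
                                                          con 2 :* (a :* a) :+ con 2 :* (b :* b) :+ (con 6 :* (a :+ b) :+ con 8)
                                                          := con 2 :* ((con 1 :+ a) :* (con 2 :+ a)) :+ con 2 :* ((con 1 :+ b) :* (con 2 :+ b)))
                                                          refl a b ⟩
    2 * (suc a * suc (suc a)) + 2 * (suc b * suc (suc b)) ≤⟨ +-mono-≤ (*-monoʳ-≤ 2 upper) (*-monoʳ-≤ 2 lower) ⟩
    2 * (2 * u + a * m₀) + 2 * (2 * l + b * m₀)      ≡⟨ solve 5 (λ a b m₀ u l →
                                                          con 2 :* (con 2 :* u :+ a :* m₀) :+ con 2 :* (con 2 :* l :+ b :* m₀)
                                                          := con 4 :* (u :+ l) :+ con 2 :* (a :+ b) :* m₀) refl a b m₀ u l ⟩
    4 * (u + l) + 2 * d * m₀                         ≤⟨ +-monoˡ-≤ (2 * d * m₀) (*-monoʳ-≤ 4 u+l≤s+3) ⟩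
    4 * (s + 3) + 2 * d * m₀                         ≡⟨ solve 3 (λ d m₀ s → con 4 :* (s :+ con 3) :+ con 2 :* d :* m₀
                                                          := con 4 :* s :+ con 2 :* d :* m₀ :+ (con 4 :+ con 8)) refl d m₀ s ⟩
    4 * s + 2 * d * m₀ + (4 + 8)                     ≤⟨ +-monoʳ-≤ (4 * s + 2 * d * m₀)
                                                          (+-monoˡ-≤ 8 (≤-trans (m≤m+n 4 4) (*-monoʳ-≤ 8 1≤d))) ⟩
    4 * s + 2 * d * m₀ + (8 * d + 8)                 ≡⟨ solve 3 (λ d m₀ s → con 4 :* s :+ con 2 :* d :* m₀ :+ (con 8 :* d :+ con 8)
                                                          := con 4 :* s :+ con 2 :* d :* (con 1 :+ m₀) :+ (con 6 :* d :+ con 8)) refl d m₀ s ⟩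
    4 * s + 2 * d * suc m₀ + (6 * d + 8)             ∎)
    where
    open ≤-Reasoning
    d = a + b

module OrderedFieldProperties {c ℓ₁ ℓ₂ : Level} (F : OrderedField c ℓ₁ ℓ₂) where

  open OrderedField F public hiding (_≤F_) renaming (+-mono-≤ to +-monoˡ-≤)
  open import Relation.Binary.Structures using (IsTotalOrder)
  open IsTotalOrder isTotalOrder public using (total; antisym)
    renaming (refl to ≤-refl; trans to ≤-trans; reflexive to ≤-reflexive; ≲-respˡ-≈ to ≤-respˡ-≈; ≲-respʳ-≈ to ≤-respʳ-≈)
  open import Algebra.Properties.Ring ring public
    using (-0#≈0#; -‿involutive; -‿+-comm; -1*x≈-x)
    renaming (x∙y⁻¹≈ε⇒x≈y to x-y≈0⇒x≈y; x≈y⇒x∙y⁻¹≈ε to x≈y⇒x-y≈0)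
  open IntegerCoefficientSolver commutativeRing public using (solve; _:+_; _:*_; :-_; _:-_; _:=_; con)
  open Classical
  open import Relation.Binary.Bundles using (TotalOrder)
  open import Relation.Binary.Reasoning.Setoid setoid
  open import Relation.Nullary using (¬_; contradiction; yes; no)
  open import Relation.Nullary.Negation using (¬¬-map)
  open import Relation.Nullary.Decidable using (¬¬-excluded-middle)
  open import Data.Sum using (_⊎_; inj₁; inj₂; reduce)
  open import Data.Product using (_×_; _,_; proj₁; proj₂)

  totalOrder : TotalOrder c ℓ₁ ℓ₂
  totalOrder = record { isTotalOrder = isTotalOrder }

  -1*-1≈1 : - 1# * - 1# ≈ 1#
  -1*-1≈1 = trans (solve 1 (λ x → :- x :* :- x := x :* x) refl 1#) (*-identityˡ 1#)

  infix 4 _≤_ _<_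
  _≤_ _<_ : Carrier → Carrier → Set ℓ₂
  _≤_ = OrderedField._≤F_ F
  x < y = ¬ (y ≤ x)

  <⇒≤ : ∀ {x y} → x < y → x ≤ y
  <⇒≤ {x} {y} x<y with total x y
  ... | inj₁ x≤y = x≤y
  ... | inj₂ y≤x = contradiction y≤x x<y

  ≤∧≉⇒< : ∀ {x y} → x ≤ y → ¬ (x ≈ y) → x < y
  ≤∧≉⇒< x≤y x≉y y≤x = x≉y (antisym x≤y y≤x)

  >0⇒≉0 : ∀ {a} → 0# < a → ¬ (a ≈ 0#)
  >0⇒≉0 0<a a≈0 = 0<a (≤-reflexive a≈0)

  <-≤-trans : ∀ {x y z} → x < y → y ≤ z → x < z
  <-≤-trans x<y y≤z z≤x = x<y (≤-trans y≤z z≤x)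

  ≤-<-trans : ∀ {x y z} → x ≤ y → y < z → x < z
  ≤-<-trans x≤y y<z z≤x = y<z (≤-trans z≤x x≤y)

  <-respˡ-≈ : ∀ {x y z} → x ≈ y → x < z → y < z
  <-respˡ-≈ x≈y x<z z≤y = x<z (≤-respʳ-≈ (sym x≈y) z≤y)

  <-respʳ-≈ : ∀ {x y z} → y ≈ z → x < y → x < z
  <-respʳ-≈ y≈z x<y z≤x = x<y (≤-respˡ-≈ (sym y≈z) z≤x)

  +-monoʳ-≤ : ∀ {x y} z → x ≤ y → z + x ≤ z + y
  +-monoʳ-≤ {x} {y} z x≤y = ≤-respʳ-≈ (+-comm y z) (≤-respˡ-≈ (+-comm x z) (+-monoˡ-≤ z x≤y))

  +-mono-≤ : ∀ {a b c d} → a ≤ b → c ≤ d → a + c ≤ b + d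
  +-mono-≤ {a} {b} {c} {d} a≤b c≤d = ≤-trans (+-monoˡ-≤ c a≤b) (+-monoʳ-≤ b c≤d)

  +-cancelˡ-≤ : ∀ {x y z} → x + y ≤ x + z → y ≤ z
  +-cancelˡ-≤ {x} {y} {z} p = ≤-respˡ-≈ (e y) (≤-respʳ-≈ (e z) (+-monoʳ-≤ (- x) p))
    where
    e : ∀ t → - x + (x + t) ≈ t
    e t = solve 2 (λ x t → :- x :+ (x :+ t) := t) refl x t

  +-mono-≤-< : ∀ {a b c d} → a ≤ b → c < d → a + c < b + d
  +-mono-≤-< {a} {b} {c} {d} a≤b c<d b+d≤a+c = c<d (+-cancelˡ-≤ (≤-trans b+d≤a+c (+-monoˡ-≤ c a≤b)))

  +-mono-<-≤ : ∀ {a b c d} → a < b → c ≤ d → a + c < b + d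
  +-mono-<-≤ {a} {b} {c} {d} a<b c≤d =
    <-respˡ-≈ (+-comm c a) (<-respʳ-≈ (+-comm d b) (+-mono-≤-< c≤d a<b))

  x≤y⇒0≤y-x : ∀ {x y} → x ≤ y → 0# ≤ y - x
  x≤y⇒0≤y-x {x} {y} x≤y = ≤-respˡ-≈ (-‿inverseʳ x) (+-monoˡ-≤ (- x) x≤y)

  0≤y-x⇒x≤y : ∀ {x y} → 0# ≤ y - x → x ≤ y
  0≤y-x⇒x≤y {x} {y} p = ≤-respˡ-≈ (+-identityˡ x) (≤-respʳ-≈ e (+-monoˡ-≤ x p))
    where
    e : (y - x) + x ≈ y
    e = solve 2 (λ x y → (y :- x) :+ x := y) refl x y

  x≤y⇒x-y≤0 : ∀ {x y} → x ≤ y → x - y ≤ 0#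
  x≤y⇒x-y≤0 {x} {y} x≤y = ≤-respʳ-≈ (-‿inverseʳ y) (+-monoˡ-≤ (- y) x≤y)

  x-y≤0⇒x≤y : ∀ {x y} → x - y ≤ 0# → x ≤ y
  x-y≤0⇒x≤y {x} {y} p = ≤-respʳ-≈ (+-identityˡ y) (≤-respˡ-≈ e (+-monoˡ-≤ y p))
    where
    e : (x - y) + y ≈ x
    e = solve 2 (λ x y → (x :- y) :+ y := x) refl x y

  x<y⇒0<y-x : ∀ {x y} → x < y → 0# < y - x
  x<y⇒0<y-x x<y y-x≤0 = x<y (x-y≤0⇒x≤y y-x≤0)

  neg-antimono-≤ : ∀ {x y} → x ≤ y → - y ≤ - x
  neg-antimono-≤ {x} {y} x≤y = 0≤y-x⇒x≤y (≤-respʳ-≈ e (x≤y⇒0≤y-x x≤y))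
    where
    e : y - x ≈ - x - - y
    e = solve 2 (λ x y → y :- x := :- x :- :- y) refl x y

  x≤0⇒0≤-x : ∀ {x} → x ≤ 0# → 0# ≤ - x
  x≤0⇒0≤-x x≤0 = ≤-respˡ-≈ -0#≈0# (neg-antimono-≤ x≤0)

  -1*x≤0⇒0≤x : ∀ {x} → - 1# * x ≤ 0# → 0# ≤ x
  -1*x≤0⇒0≤x -x≤0 = ≤-respʳ-≈ (-‿involutive _) (x≤0⇒0≤-x (≤-respˡ-≈ (-1*x≈-x _) -x≤0))

  0≤-1*x⇒x≤0 : ∀ {x} → 0# ≤ - 1# * x → x ≤ 0#
  0≤-1*x⇒x≤0 0≤-x = ≤-respʳ-≈ -0#≈0# (≤-respˡ-≈ (-‿involutive _) (neg-antimono-≤ (≤-respʳ-≈ (-1*x≈-x _) 0≤-x)))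

  *-monoˡ-≤-nonneg : ∀ {x y} z → 0# ≤ z → x ≤ y → x * z ≤ y * z
  *-monoˡ-≤-nonneg {x} {y} z 0≤z x≤y = 0≤y-x⇒x≤y (≤-respʳ-≈ e (*-nonneg (x≤y⇒0≤y-x x≤y) 0≤z))
    where
    e : (y - x) * z ≈ y * z - x * z
    e = solve 3 (λ x y z → (y :- x) :* z := y :* z :- x :* z) refl x y z

  nonneg*nonpos≤0 : ∀ {a x} → 0# ≤ a → x ≤ 0# → a * x ≤ 0#
  nonneg*nonpos≤0 {a} {x} 0≤a x≤0 = ≤-respˡ-≈ (*-comm x a) (≤-respʳ-≈ (zeroˡ a) (*-monoˡ-≤-nonneg a 0≤a x≤0))

  square-nonneg : ∀ x → 0# ≤ x * x
  square-nonneg x with total 0# x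
  ... | inj₁ 0≤x = *-nonneg 0≤x 0≤x
  ... | inj₂ x≤0 = ≤-respʳ-≈ (solve 1 (λ x → :- x :* :- x := x :* x) refl x) (*-nonneg (x≤0⇒0≤-x x≤0) (x≤0⇒0≤-x x≤0))

  neg≈0⇒≈0 : ∀ {x} → - x ≈ 0# → x ≈ 0#
  neg≈0⇒≈0 {x} -x≈0 = trans (sym (-‿involutive x)) (trans (-‿cong -x≈0) -0#≈0#)

  nonneg-+≈0 : ∀ {x y} → 0# ≤ x → 0# ≤ y → x + y ≈ 0# → x ≈ 0# × y ≈ 0#
  nonneg-+≈0 {x} {y} 0≤x 0≤y x+y≈0 = left 0≤x 0≤y x+y≈0 , left 0≤y 0≤x (trans (+-comm y x) x+y≈0)
    where
    left : ∀ {a b} → 0# ≤ a → 0# ≤ b → a + b ≈ 0# → a ≈ 0#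
    left {a} 0≤a 0≤b a+b≈0 = antisym (≤-respʳ-≈ a+b≈0 (≤-respˡ-≈ (+-identityʳ a) (+-monoʳ-≤ a 0≤b))) 0≤a

  nonneg-sum≈nonpos-sum⇒≈0 : ∀ {a b c d} → 0# ≤ a → 0# ≤ b → c ≤ 0# → d ≤ 0# → a + b ≈ c + d →
    a ≈ 0# × b ≈ 0# × c ≈ 0# × d ≈ 0#
  nonneg-sum≈nonpos-sum⇒≈0 {a} {b} {c} {d} 0≤a 0≤b c≤0 d≤0 a+b≈c+d =
    proj₁ a,b≈0 , proj₂ a,b≈0 , neg≈0⇒≈0 (proj₁ -c,-d≈0) , neg≈0⇒≈0 (proj₂ -c,-d≈0)
    where
    a+b≈0 : a + b ≈ 0#
    a+b≈0 = antisym (≤-respˡ-≈ (sym a+b≈c+d) (≤-respʳ-≈ (+-identityʳ 0#) (+-mono-≤ c≤0 d≤0)))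
                    (≤-respˡ-≈ (+-identityʳ 0#) (+-mono-≤ 0≤a 0≤b))
    a,b≈0 : a ≈ 0# × b ≈ 0#
    a,b≈0 = nonneg-+≈0 0≤a 0≤b a+b≈0
    -c,-d≈0 : - c ≈ 0# × - d ≈ 0#
    -c,-d≈0 = nonneg-+≈0 (x≤0⇒0≤-x c≤0) (x≤0⇒0≤-x d≤0)
      (trans (-‿+-comm c d) (trans (-‿cong (trans (sym a+b≈c+d) a+b≈0)) -0#≈0#))

  *≈0ʳ : ∀ {a x} → x ≈ 0# → a * x ≈ 0#
  *≈0ʳ {a} x≈0 = trans (*-congˡ x≈0) (zeroʳ a)

  ≉0∧*≈0⇒≈0 : ∀ {a x} → ¬ (a ≈ 0#) → a * x ≈ 0# → x ≈ 0#
  ≉0∧*≈0⇒≈0 {a} {x} a≉0 ax≈0 with inverse a a≉0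
  ... | a⁻¹ , aa⁻¹≈1 = begin
    x              ≈⟨ sym (*-identityˡ x) ⟩
    1# * x         ≈⟨ *-congʳ (sym aa⁻¹≈1) ⟩
    (a * a⁻¹) * x  ≈⟨ solve 3 (λ a b x → (a :* b) :* x := b :* (a :* x)) refl a a⁻¹ x ⟩
    a⁻¹ * (a * x)  ≈⟨ *≈0ʳ ax≈0 ⟩
    0#             ∎

  pos*x≥0⇒x≥0 : ∀ {a x} → 0# < a → 0# ≤ a * x → 0# ≤ x
  pos*x≥0⇒x≥0 {a} {x} 0<a 0≤ax with total 0# x
  ... | inj₁ 0≤x = 0≤x
  ... | inj₂ x≤0 = ≤-reflexive (sym (≉0∧*≈0⇒≈0 (>0⇒≉0 0<a) (antisym (nonneg*nonpos≤0 (<⇒≤ 0<a) x≤0) 0≤ax)))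

  pos*x≤0⇒x≤0 : ∀ {a x} → 0# < a → a * x ≤ 0# → x ≤ 0#
  pos*x≤0⇒x≤0 {a} {x} 0<a ax≤0 with total x 0#
  ... | inj₁ x≤0 = x≤0
  ... | inj₂ 0≤x = ≤-reflexive (≉0∧*≈0⇒≈0 (>0⇒≉0 0<a) (antisym ax≤0 (*-nonneg (<⇒≤ 0<a) 0≤x)))

  pos-weighted-sum≈0 : ∀ {p q x y} → 0# < p → 0# < q → 0# ≤ x → 0# ≤ y →
    p * x + q * y ≈ 0# → x ≈ 0# × y ≈ 0#
  pos-weighted-sum≈0 0<p 0<q 0≤x 0≤y e with nonneg-+≈0 (*-nonneg (<⇒≤ 0<p) 0≤x) (*-nonneg (<⇒≤ 0<q) 0≤y) e
  ... | px≈0 , qy≈0 = ≉0∧*≈0⇒≈0 (>0⇒≉0 0<p) px≈0 , ≉0∧*≈0⇒≈0 (>0⇒≉0 0<q) qy≈0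

  ¬¬-zero-product : ∀ {a b} → a * b ≈ 0# → ¬ ¬ (a ≈ 0# ⊎ b ≈ 0#)
  ¬¬-zero-product ab≈0 = do
    yes a≈0 ← ¬¬-excluded-middle
      where no a≉0 → return (inj₂ (≉0∧*≈0⇒≈0 a≉0 ab≈0))
    return (inj₁ a≈0)

  ¬¬-sum-of-squares≈0 : ∀ {a b} → a * a + b * b ≈ 0# → ¬ ¬ (a ≈ 0# × b ≈ 0#)
  ¬¬-sum-of-squares≈0 {a} {b} e = do
    let (aa≈0 , bb≈0) = nonneg-+≈0 (square-nonneg a) (square-nonneg b) e
    a≈0 ← ¬¬-square≈0 aa≈0
    b≈0 ← ¬¬-square≈0 bb≈0
    return (a≈0 , b≈0)
    where
    ¬¬-square≈0 : ∀ {x} → x * x ≈ 0# → ¬ ¬ (x ≈ 0#)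
    ¬¬-square≈0 xx≈0 = ¬¬-map reduce (¬¬-zero-product xx≈0)

  ¬¬-nonzero-vector-cancel : ∀ {a b x} → ¬ (a ≈ 0# × b ≈ 0#) → a * x ≈ 0# → b * x ≈ 0# → ¬ ¬ (x ≈ 0#)
  ¬¬-nonzero-vector-cancel {a} {b} ab≢0 ax≈0 bx≈0 = do
    yes a≈0 ← ¬¬-excluded-middle
      where no a≉0 → return (≉0∧*≈0⇒≈0 a≉0 ax≈0)
    yes b≈0 ← ¬¬-excluded-middle
      where no b≉0 → return (≉0∧*≈0⇒≈0 b≉0 bx≈0)
    contradiction (a≈0 , b≈0) ab≢0

module PlaneProperties {c ℓ₁ ℓ₂ : Level} (F : OrderedField c ℓ₁ ℓ₂) where

  open OrderedFieldProperties F
  open Plane F public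
  open Classical
  open import Relation.Nullary using (¬_)
  open import Relation.Nullary.Negation using (¬¬-map)
  open import Data.Integer.Base using (+_)
  open import Data.List.Relation.Unary.Any as Any using ()
  open import Data.List.Membership.Propositional using (_∈_)
  open import Data.List.Membership.Setoid.Properties using (∈-resp-≈)
  import Relation.Binary.PropositionalEquality as ≡
  open import Data.Product using (_×_; _,_; proj₁; proj₂)
  open import Data.List.Relation.Unary.All as All using (All)
  open import Relation.Binary.Bundles using (Setoid)

  pointSetoid : Setoid c ℓ₁
  pointSetoid = record
    { Carrier = Point
    ; _≈_ = _≈ₚ_
    ; isEquivalence = record
      { refl = refl , refl
      ; sym = λ (e₁ , e₂) → sym e₁ , sym e₂
      ; trans = λ (e₁ , e₂) (f₁ , f₂) → trans e₁ f₁ , trans e₂ f₂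
      }
    }

  open Setoid pointSetoid public using () renaming (refl to ≈ₚ-refl; sym to ≈ₚ-sym; trans to ≈ₚ-trans)

  +ₚ-comm : ∀ x y → (x +ₚ y) ≈ₚ (y +ₚ x)
  +ₚ-comm x y = +-comm _ _ , +-comm _ _

  +ₚ-cong : ∀ {x x′ y y′} → x ≈ₚ x′ → y ≈ₚ y′ → (x +ₚ y) ≈ₚ (x′ +ₚ y′)
  +ₚ-cong (e₁ , e₂) (f₁ , f₂) = +-cong e₁ f₁ , +-cong e₂ f₂

  lin-cong : ∀ u v {x y} → x ≈ₚ y → lin u v x ≈ lin u v y
  lin-cong u v (e₁ , e₂) = +-cong (*-congˡ e₁) (*-congˡ e₂)

  lin-+ : ∀ u v x y → lin u v (x +ₚ y) ≈ lin u v x + lin u v y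
  lin-+ u v (x₁ , x₂) (y₁ , y₂) =
    solve 6 (λ u v x₁ x₂ y₁ y₂ → u :* (x₁ :+ y₁) :+ v :* (x₂ :+ y₂) := (u :* x₁ :+ v :* x₂) :+ (u :* y₁ :+ v :* y₂))
      refl u v x₁ x₂ y₁ y₂

  ∈ₚ-resp-≈ : ∀ {x y xs} → x ≈ₚ y → x ∈ₚ xs → y ∈ₚ xs
  ∈ₚ-resp-≈ = ∈-resp-≈ pointSetoid

  ∈⇒∈ₚ : ∀ {x xs} → x ∈ xs → x ∈ₚ xs
  ∈⇒∈ₚ = Any.map (λ { ≡.refl → ≈ₚ-refl })

  lin-diff : ∀ u v x y → lin u v x - lin u v y ≈ u * (proj₁ x - proj₁ y) + v * (proj₂ x - proj₂ y)
  lin-diff u v x y = solve 6 (λ u v x₁ x₂ y₁ y₂ →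
    (u :* x₁ :+ v :* x₂) :- (u :* y₁ :+ v :* y₂) := u :* (x₁ :- y₁) :+ v :* (x₂ :- y₂))
    refl u v (proj₁ x) (proj₂ x) (proj₁ y) (proj₂ y)

  supporting-≤ : ∀ {A u v k x} → All (λ a → lin u v a ≤ k) A → x ∈ₚ A → lin u v x ≤ k
  supporting-≤ {u = u} {v} all = All.lookupₛ pointSetoid (λ x≈y → ≤-respˡ-≈ (lin-cong u v x≈y)) all

  orientation : Point → Point → Point → Carrier
  orientation a b y = (proj₁ b - proj₁ a) * (proj₂ y - proj₂ a) - (proj₂ b - proj₂ a) * (proj₁ y - proj₁ a)

  orientation-cong : ∀ a b {y y′} → y ≈ₚ y′ → orientation a b y ≈ orientation a b y′
  orientation-cong a b (e₁ , e₂) = +-cong (*-congˡ (+-congʳ e₂)) (-‿cong (*-congˡ (+-congʳ e₁)))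

  orientation-left : ∀ a b → orientation a b a ≈ 0#
  orientation-left a b = solve 4 (λ a₁ a₂ b₁ b₂ → (b₁ :- a₁) :* (a₂ :- a₂) :- (b₂ :- a₂) :* (a₁ :- a₁) := con (+ 0))
    refl (proj₁ a) (proj₂ a) (proj₁ b) (proj₂ b)

  orientation-right : ∀ a b → orientation a b b ≈ 0#
  orientation-right a b = solve 4 (λ a₁ a₂ b₁ b₂ → (b₁ :- a₁) :* (b₂ :- a₂) :- (b₂ :- a₂) :* (b₁ :- a₁) := con (+ 0))
    refl (proj₁ a) (proj₂ a) (proj₁ b) (proj₂ b)

  lin-diff≈0 : ∀ {u v x y k} → lin u v x ≈ k → lin u v y ≈ k → u * (proj₁ x - proj₁ y) + v * (proj₂ x - proj₂ y) ≈ 0#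
  lin-diff≈0 φx≈k φy≈k = trans (sym (lin-diff _ _ _ _)) (x≈y⇒x-y≈0 (trans φx≈k (sym φy≈k)))

  ¬¬-on-line⇒orientation≈0 : ∀ {u v k P Q x} → NonZeroDir u v →
    lin u v P ≈ k → lin u v Q ≈ k → lin u v x ≈ k → ¬ ¬ (orientation P Q x ≈ 0#)
  ¬¬-on-line⇒orientation≈0 {u} {v} {k} {P} {Q} {x} n≢0 φP≈k φQ≈k φx≈k = ¬¬-nonzero-vector-cancel n≢0
    (begin
      u * det                                           ≈⟨ solve 6 (λ u v d₁ d₂ y₁ y₂ →
                                                             u :* (d₁ :* y₂ :- d₂ :* y₁)
                                                             := y₂ :* (u :* d₁ :+ v :* d₂) :- d₂ :* (u :* y₁ :+ v :* y₂))
                                                             refl u v d₁ d₂ y₁ y₂ ⟩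
      y₂ * (u * d₁ + v * d₂) - d₂ * (u * y₁ + v * y₂)   ≈⟨ +-cong (*≈0ʳ nd≈0) (-‿cong (*≈0ʳ ny≈0)) ⟩
      0# - 0#                                           ≈⟨ -‿inverseʳ 0# ⟩
      0#                                                ∎)
    (begin
      v * det                                           ≈⟨ solve 6 (λ u v d₁ d₂ y₁ y₂ →
                                                             v :* (d₁ :* y₂ :- d₂ :* y₁)
                                                             := d₁ :* (u :* y₁ :+ v :* y₂) :- y₁ :* (u :* d₁ :+ v :* d₂))
                                                             refl u v d₁ d₂ y₁ y₂ ⟩
      d₁ * (u * y₁ + v * y₂) - y₁ * (u * d₁ + v * d₂)   ≈⟨ +-cong (*≈0ʳ ny≈0) (-‿cong (*≈0ʳ nd≈0)) ⟩
      0# - 0#                                           ≈⟨ -‿inverseʳ 0# ⟩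
      0#                                                ∎)
    where
    open import Relation.Binary.Reasoning.Setoid setoid
    d₁ d₂ y₁ y₂ det : Carrier
    d₁ = proj₁ Q - proj₁ P
    d₂ = proj₂ Q - proj₂ P
    y₁ = proj₁ x - proj₁ P
    y₂ = proj₂ x - proj₂ P
    det = orientation P Q x
    nd≈0 : u * d₁ + v * d₂ ≈ 0#
    nd≈0 = lin-diff≈0 φQ≈k φP≈k
    ny≈0 : u * y₁ + v * y₂ ≈ 0#
    ny≈0 = lin-diff≈0 φx≈k φP≈k

  ¬¬-orientation≈0⇒on-line : ∀ {u v k P Q x} → ¬ (P ≈ₚ Q) → orientation P Q x ≈ 0# →
    lin u v P ≈ k → lin u v Q ≈ k → ¬ ¬ (lin u v x ≈ k)
  ¬¬-orientation≈0⇒on-line {u} {v} {k} {P} {Q} {x} P≉Q det≈0 φP≈k φQ≈k =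
    ¬¬-map (λ φy≈0 → trans (x-y≈0⇒x≈y _ _ (trans (lin-diff u v x P) φy≈0)) φP≈k)
      (¬¬-nonzero-vector-cancel d≢0
        (begin
          d₁ * (u * y₁ + v * y₂)                ≈⟨ solve 6 (λ u v d₁ d₂ y₁ y₂ →
                                                     d₁ :* (u :* y₁ :+ v :* y₂)
                                                     := y₁ :* (u :* d₁ :+ v :* d₂) :+ v :* (d₁ :* y₂ :- d₂ :* y₁))
                                                     refl u v d₁ d₂ y₁ y₂ ⟩
          y₁ * (u * d₁ + v * d₂) + v * det      ≈⟨ +-cong (*≈0ʳ nd≈0) (*≈0ʳ det≈0) ⟩
          0# + 0#                               ≈⟨ +-identityʳ 0# ⟩
          0#                                    ∎)
        (begin
          d₂ * (u * y₁ + v * y₂)                ≈⟨ solve 6 (λ u v d₁ d₂ y₁ y₂ →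
                                                     d₂ :* (u :* y₁ :+ v :* y₂)
                                                     := y₂ :* (u :* d₁ :+ v :* d₂) :- u :* (d₁ :* y₂ :- d₂ :* y₁))
                                                     refl u v d₁ d₂ y₁ y₂ ⟩
          y₂ * (u * d₁ + v * d₂) - u * det      ≈⟨ +-cong (*≈0ʳ nd≈0) (-‿cong (*≈0ʳ det≈0)) ⟩
          0# - 0#                               ≈⟨ -‿inverseʳ 0# ⟩
          0#                                    ∎))
    where
    open import Relation.Binary.Reasoning.Setoid setoid
    d₁ d₂ y₁ y₂ det : Carrier
    d₁ = proj₁ Q - proj₁ P
    d₂ = proj₂ Q - proj₂ P
    y₁ = proj₁ x - proj₁ P
    y₂ = proj₂ x - proj₂ P
    det = orientation P Q x
    nd≈0 : u * d₁ + v * d₂ ≈ 0#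
    nd≈0 = lin-diff≈0 φQ≈k φP≈k
    d≢0 : ¬ (d₁ ≈ 0# × d₂ ≈ 0#)
    d≢0 (d₁≈0 , d₂≈0) = P≉Q (sym (x-y≈0⇒x≈y _ _ d₁≈0) , sym (x-y≈0⇒x≈y _ _ d₂≈0))

  ¬¬-lines-through-two-points-agree : ∀ {u v k u′ v′ k′ P Q x} → NonZeroDir u v → ¬ (P ≈ₚ Q) →
    lin u v P ≈ k → lin u v Q ≈ k → lin u′ v′ P ≈ k′ → lin u′ v′ Q ≈ k′ →
    lin u v x ≈ k → ¬ ¬ (lin u′ v′ x ≈ k′)
  ¬¬-lines-through-two-points-agree n≢0 P≉Q φP≈k φQ≈k φ′P≈k′ φ′Q≈k′ φx≈k = do
    det≈0 ← ¬¬-on-line⇒orientation≈0 n≢0 φP≈k φQ≈k φx≈k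
    ¬¬-orientation≈0⇒on-line P≉Q det≈0 φ′P≈k′ φ′Q≈k′

module DiameterFrame {c ℓ₁ ℓ₂ : Level} (F : OrderedField c ℓ₁ ℓ₂) (A : List (Plane.Point F)) (p q : Plane.Point F) where

  open OrderedFieldProperties F
  open PlaneProperties F
  open Classical
  open import Relation.Nullary.Negation using (¬¬-map)
  open import Data.Sum using (_⊎_; inj₁; inj₂; [_,_]′)
  open import Data.Product using (_×_; _,_; proj₁; proj₂; Σ-syntax)
  open import Data.List using ([]; _∷_)
  open import Data.List.Relation.Unary.Any using (here; there)
  open import Data.List.Relation.Unary.All as All using ()
  open import Relation.Nullary using (¬_; contradiction; yes; no)
  open import Relation.Nullary.Decidable using (¬¬-excluded-middle)
  open import Function using (_∘_)
  open import Relation.Binary.Reasoning.Setoid setoid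

  w₁ w₂ : Carrier
  w₁ = proj₁ q - proj₁ p
  w₂ = proj₂ q - proj₂ p

  G : Point → Carrier
  G = lin w₁ w₂

  ‖w‖² : Carrier
  ‖w‖² = w₁ * w₁ + w₂ * w₂

  w·_,_ w×_,_ : Carrier → Carrier → Carrier
  w· u , v = w₁ * u + w₂ * v
  w× u , v = w₁ * v - w₂ * u

  -- For y between a and b along pq, on a supporting line φ = k, both summands on the left are ≥ 0.
  chord-identity : ∀ u v a b y →
    (G b - G y) * (lin u v y - lin u v a) + (G y - G a) * (lin u v y - lin u v b) ≈ (w× u , v) * orientation a b y
  chord-identity u v a b y = solve 10 (λ w₁ w₂ u v a₁ a₂ b₁ b₂ y₁ y₂ →
    ((w₁ :* b₁ :+ w₂ :* b₂) :- (w₁ :* y₁ :+ w₂ :* y₂)) :* ((u :* y₁ :+ v :* y₂) :- (u :* a₁ :+ v :* a₂)) :+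
    ((w₁ :* y₁ :+ w₂ :* y₂) :- (w₁ :* a₁ :+ w₂ :* a₂)) :* ((u :* y₁ :+ v :* y₂) :- (u :* b₁ :+ v :* b₂))
    := (w₁ :* v :- w₂ :* u) :* ((b₁ :- a₁) :* (y₂ :- a₂) :- (b₂ :- a₂) :* (y₁ :- a₁)))
    refl w₁ w₂ u v (proj₁ a) (proj₂ a) (proj₁ b) (proj₂ b) (proj₁ y) (proj₂ y)

  w×-diff : Point → Point → Carrier
  w×-diff x y = w× (proj₁ x - proj₁ y) , (proj₂ x - proj₂ y)

  -- Lagrange's identity ‖w‖² (n · d) = (w · n) (w · d) + (w × n) (w × d) for the normal n = (u, v) and d = x - y.
  lagrange-identity : ∀ u v x y → ‖w‖² * (lin u v x - lin u v y) ≈ (w· u , v) * (G x - G y) + (w× u , v) * w×-diff x y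
  lagrange-identity u v x y = solve 8 (λ w₁ w₂ u v x₁ x₂ y₁ y₂ →
    (w₁ :* w₁ :+ w₂ :* w₂) :* ((u :* x₁ :+ v :* x₂) :- (u :* y₁ :+ v :* y₂))
    := (w₁ :* u :+ w₂ :* v) :* ((w₁ :* x₁ :+ w₂ :* x₂) :- (w₁ :* y₁ :+ w₂ :* y₂))
       :+ (w₁ :* v :- w₂ :* u) :* (w₁ :* (x₂ :- y₂) :- w₂ :* (x₁ :- y₁)))
    refl w₁ w₂ u v (proj₁ x) (proj₂ x) (proj₁ y) (proj₂ y)

  w·≈0∧w×≈0⇒≈0 : ¬ (‖w‖² ≈ 0#) → ∀ {u v} → w· u , v ≈ 0# → w× u , v ≈ 0# → u ≈ 0# × v ≈ 0#
  w·≈0∧w×≈0⇒≈0 ‖w‖²≉0 {u} {v} w·≈0 w×≈0 =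
    ≉0∧*≈0⇒≈0 ‖w‖²≉0 (begin
      ‖w‖² * u                          ≈⟨ solve 4 (λ w₁ w₂ u v → (w₁ :* w₁ :+ w₂ :* w₂) :* u
                                             := w₁ :* (w₁ :* u :+ w₂ :* v) :- w₂ :* (w₁ :* v :- w₂ :* u)) refl w₁ w₂ u v ⟩
      w₁ * (w· u , v) - w₂ * (w× u , v) ≈⟨ +-cong (*≈0ʳ w·≈0) (-‿cong (*≈0ʳ w×≈0)) ⟩
      0# - 0#                           ≈⟨ -‿inverseʳ 0# ⟩
      0#                                ∎) ,
    ≉0∧*≈0⇒≈0 ‖w‖²≉0 (begin
      ‖w‖² * v                          ≈⟨ solve 4 (λ w₁ w₂ u v → (w₁ :* w₁ :+ w₂ :* w₂) :* v
                                             := w₂ :* (w₁ :* u :+ w₂ :* v) :+ w₁ :* (w₁ :* v :- w₂ :* u)) refl w₁ w₂ u v ⟩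
      w₂ * (w· u , v) + w₁ * (w× u , v) ≈⟨ +-cong (*≈0ʳ w·≈0) (*≈0ʳ w×≈0) ⟩
      0# + 0#                           ≈⟨ +-identityʳ 0# ⟩
      0#                                ∎)

  orientation-+ : ∀ a b {x y x′ y′} → (x +ₚ y) ≈ₚ (x′ +ₚ y′) →
    orientation a b x + orientation a b y ≈ orientation a b x′ + orientation a b y′
  orientation-+ a b {x} {y} {x′} {y′} (e₁ , e₂) = x-y≈0⇒x≈y _ _ (begin
    (orientation a b x + orientation a b y) - (orientation a b x′ + orientation a b y′)
      ≈⟨ solve 12 (λ a₁ a₂ b₁ b₂ x₁ x₂ y₁ y₂ x₁′ x₂′ y₁′ y₂′ →
           (((b₁ :- a₁) :* (x₂ :- a₂) :- (b₂ :- a₂) :* (x₁ :- a₁))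
             :+ ((b₁ :- a₁) :* (y₂ :- a₂) :- (b₂ :- a₂) :* (y₁ :- a₁))) :-
           (((b₁ :- a₁) :* (x₂′ :- a₂) :- (b₂ :- a₂) :* (x₁′ :- a₁))
             :+ ((b₁ :- a₁) :* (y₂′ :- a₂) :- (b₂ :- a₂) :* (y₁′ :- a₁)))
           := (b₁ :- a₁) :* ((x₂ :+ y₂) :- (x₂′ :+ y₂′)) :- (b₂ :- a₂) :* ((x₁ :+ y₁) :- (x₁′ :+ y₁′)))
           refl (proj₁ a) (proj₂ a) (proj₁ b) (proj₂ b) (proj₁ x) (proj₂ x) (proj₁ y) (proj₂ y)
           (proj₁ x′) (proj₂ x′) (proj₁ y′) (proj₂ y′) ⟩
    (proj₁ b - proj₁ a) * ((proj₂ x + proj₂ y) - (proj₂ x′ + proj₂ y′))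
      - (proj₂ b - proj₂ a) * ((proj₁ x + proj₁ y) - (proj₁ x′ + proj₁ y′))
      ≈⟨ +-cong (*≈0ʳ (x≈y⇒x-y≈0 e₂)) (-‿cong (*≈0ʳ (x≈y⇒x-y≈0 e₁))) ⟩
    0# - 0#
      ≈⟨ -‿inverseʳ 0# ⟩
    0# ∎)

  orientation-sum≈0 : ∀ {a b c e} → (c +ₚ e) ≈ₚ (a +ₚ b) → orientation a b c + orientation a b e ≈ 0#
  orientation-sum≈0 {a} {b} c+e≈a+b =
    trans (orientation-+ a b c+e≈a+b) (trans (+-cong (orientation-left a b) (orientation-right a b)) (+-identityʳ 0#))

  chord-line-identity : ∀ u v k a b y → lin u v a ≈ k → lin u v b ≈ k →
    (G b - G a) * (lin u v y - k) ≈ (w× u , v) * orientation a b y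
  chord-line-identity u v k a b y φa≈k φb≈k = begin
    (G b - G a) * (φy - k)                             ≈⟨ solve 5 (λ Ga Gb Gy φy k → (Gb :- Ga) :* (φy :- k)
                                                            := (Gb :- Gy) :* (φy :- k) :+ (Gy :- Ga) :* (φy :- k))
                                                            refl (G a) (G b) (G y) φy k ⟩
    (G b - G y) * (φy - k) + (G y - G a) * (φy - k)    ≈⟨ sym (+-cong (*-congˡ (+-congˡ (-‿cong φa≈k)))
                                                                   (*-congˡ (+-congˡ (-‿cong φb≈k)))) ⟩
    (G b - G y) * (φy - lin u v a) + (G y - G a) * (φy - lin u v b) ≈⟨ chord-identity u v a b y ⟩
    (w× u , v) * orientation a b y                    ∎
    where φy = lin u v y

  supporting-line-contains-chord : ∀ {u v k a b c} → IsSupporting A u v k → a ∈ₚ A → b ∈ₚ A →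
    G a < G c → G c < G b → lin u v c ≈ k → orientation a b c ≈ 0# → lin u v a ≈ k × lin u v b ≈ k
  supporting-line-contains-chord {u} {v} {k} {a} {b} {c} (_ , below) a∈A b∈A a<c c<b φc≈k orient≈0 =
    on-line a∈A (proj₁ both≈0) , on-line b∈A (proj₂ both≈0)
    where
    gap : ∀ {x} → x ∈ₚ A → 0# ≤ lin u v c - lin u v x
    gap x∈A = x≤y⇒0≤y-x (≤-respʳ-≈ (sym φc≈k) (supporting-≤ below x∈A))
    both≈0 : lin u v c - lin u v a ≈ 0# × lin u v c - lin u v b ≈ 0#
    both≈0 = pos-weighted-sum≈0 (x<y⇒0<y-x c<b) (x<y⇒0<y-x a<c) (gap a∈A) (gap b∈A)
               (trans (chord-identity u v a b c) (*≈0ʳ orient≈0))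
    on-line : ∀ {x} → x ∈ₚ A → lin u v c - lin u v x ≈ 0# → lin u v x ≈ k
    on-line _ e = trans (sym (x-y≈0⇒x≈y _ _ e)) φc≈k

  record Extremal : Set (c ⊔ ℓ₁ ⊔ ℓ₂) where
    field
      p∈A : p ∈ₚ A
      q∈A : q ∈ₚ A
      ‖w‖²>0 : 0# < ‖w‖²
      p-unique-min : ∀ x → x ∈ₚ A → G x ≤ G p → ¬ ¬ (x ≈ₚ p)
      q-unique-max : ∀ x → x ∈ₚ A → G q ≤ G x → ¬ ¬ (x ≈ₚ q)

  -- The boundary points of [A] other than p and q on the upper (σ = 1) or lower (σ = -1) arc from p to q:
  -- y lies on a supporting line whose outward normal points to the side σ of the line pq.
  OnOpenArc : Carrier → Point → Set (c ⊔ ℓ₁ ⊔ ℓ₂)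
  OnOpenArc σ y = Σ[ u ∈ Carrier ] Σ[ v ∈ Carrier ] Σ[ k ∈ Carrier ]
    (IsSupporting A u v k × lin u v y ≈ k × 0# < σ * (w× u , v))

  IsEnd : Point → Set ℓ₁
  IsEnd y = y ≈ₚ p ⊎ y ≈ₚ q

  OnArc : Carrier → Point → Set (c ⊔ ℓ₁ ⊔ ℓ₂)
  OnArc σ y = OnOpenArc σ y ⊎ IsEnd y

  module Arcs (ext : Extremal) where

    open Extremal ext

    ‖w‖²≉0 : ¬ (‖w‖² ≈ 0#)
    ‖w‖²≉0 = >0⇒≉0 ‖w‖²>0

    G-≤q : ∀ x → x ∈ₚ A → ¬ ¬ (G x ≤ G q)
    G-≤q x x∈A with total (G x) (G q)
    ... | inj₁ x≤q = return x≤q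
    ... | inj₂ q≤x = ¬¬-map (λ x≈q → ≤-reflexive (lin-cong w₁ w₂ x≈q)) (q-unique-max x x∈A q≤x)

    G-≥p : ∀ x → x ∈ₚ A → ¬ ¬ (G p ≤ G x)
    G-≥p x x∈A with total (G p) (G x)
    ... | inj₁ p≤x = return p≤x
    ... | inj₂ x≤p = ¬¬-map (λ x≈p → ≤-reflexive (lin-cong w₁ w₂ (≈ₚ-sym x≈p))) (p-unique-min x x∈A x≤p)

    Gp<Gq : G p < G q
    Gp<Gq q≤p = ‖w‖²>0 (≤-respˡ-≈ Gq-Gp≈‖w‖² (x≤y⇒x-y≤0 q≤p))
      where
      Gq-Gp≈‖w‖² : G q - G p ≈ ‖w‖²
      Gq-Gp≈‖w‖² = solve 4 (λ p₁ p₂ q₁ q₂ →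
                                            ((q₁ :- p₁) :* q₁ :+ (q₂ :- p₂) :* q₂) :- ((q₁ :- p₁) :* p₁ :+ (q₂ :- p₂) :* p₂)
                                            := (q₁ :- p₁) :* (q₁ :- p₁) :+ (q₂ :- p₂) :* (q₂ :- p₂))
                     refl (proj₁ p) (proj₂ p) (proj₁ q) (proj₂ q)

    module Side (σ : Carrier) (σ²≈1 : σ * σ ≈ 1#) where

      *-σσ : ∀ X Y → X * Y ≈ (σ * X) * (σ * Y)
      *-σσ X Y = begin
        X * Y               ≈⟨ sym (*-identityˡ (X * Y)) ⟩
        1# * (X * Y)        ≈⟨ *-congʳ (sym σ²≈1) ⟩
        (σ * σ) * (X * Y)   ≈⟨ solve 3 (λ s X Y → (s :* s) :* (X :* Y) := (s :* X) :* (s :* Y)) refl σ X Y ⟩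
        (σ * X) * (σ * Y)   ∎

      σ*≈0⇒≈0 : ∀ {X} → σ * X ≈ 0# → X ≈ 0#
      σ*≈0⇒≈0 {X} σX≈0 = begin
        X             ≈⟨ sym (*-identityˡ X) ⟩
        1# * X        ≈⟨ *-congʳ (sym σ²≈1) ⟩
        (σ * σ) * X   ≈⟨ *-assoc σ σ X ⟩
        σ * (σ * X)   ≈⟨ *≈0ʳ σX≈0 ⟩
        0#            ∎

      open-arc-above-chord : ∀ {a b y} → a ∈ₚ A → b ∈ₚ A → G a ≤ G y → G y ≤ G b → OnOpenArc σ y →
        0# ≤ σ * orientation a b y
      open-arc-above-chord {a} {b} {y} a∈A b∈A a≤y y≤b (u , v , k , (_ , below) , φy≈k , facing>0) =
        pos*x≥0⇒x≥0 facing>0 (≤-respʳ-≈ (trans (chord-identity u v a b y) (*-σσ _ _))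
          (≤-respˡ-≈ (+-identityʳ 0#)
            (+-mono-≤ (*-nonneg (x≤y⇒0≤y-x y≤b) (gap a∈A)) (*-nonneg (x≤y⇒0≤y-x a≤y) (gap b∈A)))))
        where
        gap : ∀ {x} → x ∈ₚ A → 0# ≤ lin u v y - lin u v x
        gap x∈A = x≤y⇒0≤y-x (≤-respʳ-≈ (sym φy≈k) (supporting-≤ below x∈A))

      arc-above-chord : ∀ {a b y} → a ∈ₚ A → b ∈ₚ A → G a ≤ G y → G y ≤ G b → OnArc σ y →
        ¬ ¬ (0# ≤ σ * orientation a b y)
      arc-above-chord a∈A b∈A a≤y y≤b (inj₁ open-arc) = return (open-arc-above-chord a∈A b∈A a≤y y≤b open-arc)
      arc-above-chord {a} {b} a∈A b∈A a≤y y≤b (inj₂ (inj₁ y≈p)) = do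
        a≈p ← p-unique-min a a∈A (≤-respʳ-≈ (lin-cong w₁ w₂ y≈p) a≤y)
        return (≤-reflexive (sym (*≈0ʳ (trans (orientation-cong a b (≈ₚ-trans y≈p (≈ₚ-sym a≈p))) (orientation-left a b)))))
      arc-above-chord {a} {b} a∈A b∈A a≤y y≤b (inj₂ (inj₂ y≈q)) = do
        b≈q ← q-unique-max b b∈A (≤-respˡ-≈ (lin-cong w₁ w₂ y≈q) y≤b)
        return (≤-reflexive (sym (*≈0ʳ (trans (orientation-cong a b (≈ₚ-trans y≈q (≈ₚ-sym b≈q))) (orientation-right a b)))))

      ArcPieceOn : Carrier → Carrier → Carrier → Carrier → Carrier → Set (c ⊔ ℓ₁ ⊔ ℓ₂)
      ArcPieceOn u v k g₀ g₁ = ∀ y → y ∈ₚ A → OnArc σ y → g₀ ≤ G y → G y ≤ g₁ → ¬ ¬ (lin u v y ≈ k)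

      equal-sums⇒straight-arc : ∀ {a b c e} → a ∈ₚ A → b ∈ₚ A → e ∈ₚ A → OnArc σ c → OnArc σ e →
        G a < G c → G c ≤ G e → G e < G b → (c +ₚ e) ≈ₚ (a +ₚ b) →
        ¬ ¬ (Σ[ u ∈ Carrier ] Σ[ v ∈ Carrier ] Σ[ k ∈ Carrier ] (IsSupporting A u v k × ArcPieceOn u v k (G a) (G b)))
      equal-sums⇒straight-arc {a} {b} {c} {e} a∈A b∈A e∈A c-on-arc e-on-arc a<c c≤e e<b c+e≈a+b = do
        (u , v , k , supporting , φc≈k , facing>0) ← c-on-open-arc c-on-arc
        0≤σe ← arc-above-chord a∈A b∈A (≤-trans (<⇒≤ a<c) c≤e) (<⇒≤ e<b) e-on-arc
        let 0≤σc = open-arc-above-chord a∈A b∈A (<⇒≤ a<c) (<⇒≤ c<b) (u , v , k , supporting , φc≈k , facing>0)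
            σc≈0 = proj₁ (nonneg-+≈0 0≤σc 0≤σe (trans (sym (distribˡ σ _ _)) (*≈0ʳ (orientation-sum≈0 c+e≈a+b))))
            (φa≈k , φb≈k) = supporting-line-contains-chord supporting a∈A b∈A a<c c<b φc≈k (σ*≈0⇒≈0 σc≈0)
            on-line : ArcPieceOn u v k (G a) (G b)
            on-line y y∈A y-on-arc a≤y y≤b = do
              0≤σy ← arc-above-chord a∈A b∈A a≤y y≤b y-on-arc
              let 0≤gap = ≤-respʳ-≈ (trans (sym (*-σσ _ _)) (sym (chord-line-identity u v k a b y φa≈k φb≈k)))
                                    (*-nonneg (<⇒≤ facing>0) 0≤σy)
              return (antisym (supporting-≤ (proj₂ supporting) y∈A) (0≤y-x⇒x≤y (pos*x≥0⇒x≥0 (x<y⇒0<y-x a<b) 0≤gap)))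
        return (u , v , k , supporting , on-line)
        where
        c<b : G c < G b
        c<b = ≤-<-trans c≤e e<b
        a<b : G a < G b
        a<b = <-≤-trans a<c (<⇒≤ c<b)
        c-on-open-arc : OnArc σ c → ¬ ¬ OnOpenArc σ c
        c-on-open-arc (inj₁ open-arc) = return open-arc
        c-on-open-arc (inj₂ (inj₁ c≈p)) = do
          p≤a ← G-≥p a a∈A
          contradiction (≤-respˡ-≈ (sym (lin-cong w₁ w₂ c≈p)) p≤a) a<c
        c-on-open-arc (inj₂ (inj₂ c≈q)) = do
          b≤q ← G-≤q b b∈A
          contradiction (≤-trans b≤q (≤-respˡ-≈ (lin-cong w₁ w₂ c≈q) c≤e)) e<b

      open-arc-G-injective : ∀ {y y′} → y ∈ₚ A → y′ ∈ₚ A → OnOpenArc σ y → OnOpenArc σ y′ →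
        G y ≈ G y′ → y ≈ₚ y′
      open-arc-G-injective {y} {y′} y∈A y′∈A y-on-arc y′-on-arc Gy≈Gy′ =
        ≈ₚ-sym (x-y≈0⇒x≈y _ _ (proj₁ d≈0) , x-y≈0⇒x≈y _ _ (proj₂ d≈0))
        where
        -- By the Lagrange identity, the line through z sees only the w× part of x - z when G x = G z.
        beyond : ∀ {x z} → OnOpenArc σ z → x ∈ₚ A → G x ≈ G z → σ * w×-diff x z ≤ 0#
        beyond {x} {z} (u , v , k , (_ , below) , φz≈k , facing>0) x∈A Gx≈Gz =
          pos*x≤0⇒x≤0 facing>0 (≤-respˡ-≈ lagrange (nonneg*nonpos≤0 (<⇒≤ ‖w‖²>0)
            (x≤y⇒x-y≤0 (≤-respʳ-≈ (sym φz≈k) (supporting-≤ below x∈A)))))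
          where
          lagrange : ‖w‖² * (lin u v x - lin u v z) ≈ (σ * (w× u , v)) * (σ * w×-diff x z)
          lagrange = begin
            ‖w‖² * (lin u v x - lin u v z)                          ≈⟨ lagrange-identity u v x z ⟩
            (w· u , v) * (G x - G z) + (w× u , v) * w×-diff x z     ≈⟨ +-congʳ (*≈0ʳ (x≈y⇒x-y≈0 Gx≈Gz)) ⟩
            0# + (w× u , v) * w×-diff x z                           ≈⟨ +-identityˡ _ ⟩
            (w× u , v) * w×-diff x z                                ≈⟨ *-σσ _ _ ⟩
            (σ * (w× u , v)) * (σ * w×-diff x z)                    ∎
        antisymmetric : σ * w×-diff y y′ ≈ - (σ * w×-diff y′ y)
        antisymmetric = solve 7 (λ s w₁ w₂ a₁ a₂ b₁ b₂ → s :* (w₁ :* (a₂ :- b₂) :- w₂ :* (a₁ :- b₁))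
                                                        := :- (s :* (w₁ :* (b₂ :- a₂) :- w₂ :* (b₁ :- a₁))))
                          refl σ w₁ w₂ (proj₁ y) (proj₂ y) (proj₁ y′) (proj₂ y′)
        σw×≈0 : σ * w×-diff y′ y ≈ 0#
        σw×≈0 = antisym (beyond y-on-arc y′∈A (sym Gy≈Gy′))
          (≤-respʳ-≈ (-‿involutive _) (x≤0⇒0≤-x (≤-respˡ-≈ antisymmetric (beyond y′-on-arc y∈A Gy≈Gy′))))
        d≈0 : proj₁ y′ - proj₁ y ≈ 0# × proj₂ y′ - proj₂ y ≈ 0#
        d≈0 = w·≈0∧w×≈0⇒≈0 ‖w‖²≉0 (trans (sym (lin-diff w₁ w₂ y′ y)) (x≈y⇒x-y≈0 (sym Gy≈Gy′)))
                (σ*≈0⇒≈0 σw×≈0)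

      arc-beside-pq : ∀ {y} → y ∈ₚ A → OnArc σ y → ¬ ¬ (0# ≤ σ * orientation p q y)
      arc-beside-pq {y} y∈A y-arc = do
        p≤y ← G-≥p y y∈A
        y≤q ← G-≤q y y∈A
        arc-above-chord p∈A q∈A p≤y y≤q y-arc

      interior-on-pq⇒A-beside-pq : ∀ {y} → y ∈ₚ A → OnArc σ y → ¬ IsEnd y → orientation p q y ≈ 0# →
        ∀ x → x ∈ₚ A → σ * orientation p q x ≤ 0#
      interior-on-pq⇒A-beside-pq _ (inj₂ end) ¬end = contradiction end ¬end
      interior-on-pq⇒A-beside-pq {y} y∈A (inj₁ (u , v , k , supporting , φy≈k , facing>0)) ¬end orient≈0 x x∈A =
        pos*x≤0⇒x≤0 facing>0 (≤-respˡ-≈ identity (nonneg*nonpos≤0 (x≤y⇒0≤y-x (<⇒≤ Gp<Gq))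
          (x≤y⇒x-y≤0 (supporting-≤ (proj₂ supporting) x∈A))))
        where
        p<y : G p < G y
        p<y y≤p = p-unique-min y y∈A y≤p (¬end ∘ inj₁)
        y<q : G y < G q
        y<q q≤y = q-unique-max y y∈A q≤y (¬end ∘ inj₂)
        φp,q≈k : lin u v p ≈ k × lin u v q ≈ k
        φp,q≈k = supporting-line-contains-chord supporting p∈A q∈A p<y y<q φy≈k orient≈0
        identity : (G q - G p) * (lin u v x - k) ≈ (σ * (w× u , v)) * (σ * orientation p q x)
        identity = trans (chord-line-identity u v k p q x (proj₁ φp,q≈k) (proj₂ φp,q≈k)) (*-σσ _ _)

    module Upper = Side 1# (*-identityˡ 1#)
    module Lower = Side (- 1#) -1*-1≈1

    w≢0 : ¬ (w₁ ≈ 0# × w₂ ≈ 0#)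
    w≢0 (w₁≈0 , w₂≈0) = ‖w‖²≉0 (trans (+-cong (*≈0ʳ w₁≈0) (*≈0ʳ w₂≈0)) (+-identityʳ 0#))

    p-on-boundary : ¬ ¬ OnBoundary A p
    p-on-boundary = do
      below ← ¬¬-all A (λ x x∈A →
        ¬¬-map (λ p≤x → ≤-respˡ-≈ (sym (neg-lin x)) (neg-antimono-≤ p≤x)) (G-≥p x (∈⇒∈ₚ x∈A)))
      return (- w₁ , - w₂ , - G p , ((λ (e₁ , e₂) → w≢0 (neg≈0⇒≈0 e₁ , neg≈0⇒≈0 e₂)) , below) , neg-lin p)
      where
      neg-lin : ∀ x → lin (- w₁) (- w₂) x ≈ - G x
      neg-lin x = solve 4 (λ w₁ w₂ x₁ x₂ → :- w₁ :* x₁ :+ :- w₂ :* x₂ := :- (w₁ :* x₁ :+ w₂ :* x₂))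
        refl w₁ w₂ (proj₁ x) (proj₂ x)

    q-on-boundary : ¬ ¬ OnBoundary A q
    q-on-boundary = do
      below ← ¬¬-all A (λ x x∈A → G-≤q x (∈⇒∈ₚ x∈A))
      return (w₁ , w₂ , G q , (w≢0 , below) , refl)

    boundary-trichotomy : ∀ {b} → b ∈ₚ A → OnBoundary A b → ¬ ¬ (OnOpenArc 1# b ⊎ OnOpenArc (- 1#) b ⊎ IsEnd b)
    boundary-trichotomy {b} b∈A (u , v , k , supporting@(n≢0 , below) , φb≈k) = do
      yes w×≈0 ← ¬¬-excluded-middle
        where no w×≉0 → return (tilted w×≉0 (total 0# (w× u , v)))
      yes w·≈0 ← ¬¬-excluded-middle
        where no w·≉0 → ¬¬-map (inj₂ ∘ inj₂) (parallel w×≈0 w·≉0 (total 0# (w· u , v)))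
      contradiction (w·≈0∧w×≈0⇒≈0 ‖w‖²≉0 w·≈0 w×≈0) n≢0
      where
      tilted : ¬ (w× u , v ≈ 0#) → 0# ≤ (w× u , v) ⊎ (w× u , v) ≤ 0# → OnOpenArc 1# b ⊎ OnOpenArc (- 1#) b ⊎ IsEnd b
      tilted w×≉0 (inj₁ 0≤w×) =
        inj₁ (u , v , k , supporting , φb≈k , <-respʳ-≈ (sym (*-identityˡ _)) (≤∧≉⇒< 0≤w× (λ e → w×≉0 (sym e))))
      tilted w×≉0 (inj₂ w×≤0) =
        inj₂ (inj₁ (u , v , k , supporting , φb≈k ,
          <-respʳ-≈ (sym (-1*x≈-x _)) (≤∧≉⇒< (x≤0⇒0≤-x w×≤0) (λ e → w×≉0 (neg≈0⇒≈0 (sym e))))))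
      -- With the normal parallel to q - p, the line is a level set of G, so b is extremal for G.
      G-below : w× u , v ≈ 0# → ∀ {x} → x ∈ₚ A → (w· u , v) * (G x - G b) ≤ 0#
      G-below w×≈0 {x} x∈A = ≤-respˡ-≈ lagrange
        (nonneg*nonpos≤0 (<⇒≤ ‖w‖²>0) (x≤y⇒x-y≤0 (≤-respʳ-≈ (sym φb≈k) (supporting-≤ below x∈A))))
        where
        lagrange : ‖w‖² * (lin u v x - lin u v b) ≈ (w· u , v) * (G x - G b)
        lagrange = trans (lagrange-identity u v x b) (trans (+-congˡ (trans (*-congʳ w×≈0) (zeroˡ _))) (+-identityʳ _))
      parallel : w× u , v ≈ 0# → ¬ (w· u , v ≈ 0#) → 0# ≤ (w· u , v) ⊎ (w· u , v) ≤ 0# → ¬ ¬ (b ≈ₚ p ⊎ b ≈ₚ q)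
      parallel w×≈0 w·≉0 (inj₁ 0≤w·) =
        ¬¬-map inj₂ (q-unique-max b b∈A
          (x-y≤0⇒x≤y (pos*x≤0⇒x≤0 (≤∧≉⇒< 0≤w· (λ e → w·≉0 (sym e))) (G-below w×≈0 q∈A))))
      parallel w×≈0 w·≉0 (inj₂ w·≤0) =
        ¬¬-map inj₁ (p-unique-min b b∈A
          (x-y≤0⇒x≤y (pos*x≤0⇒x≤0 (≤∧≉⇒< (x≤0⇒0≤-x w·≤0) (λ e → w·≉0 (neg≈0⇒≈0 (sym e))))
          (≤-respˡ-≈ (solve 3 (λ E x y → E :* (x :- y) := :- E :* (y :- x)) refl _ (G p) (G b)) (G-below w×≈0 p∈A)))))

    orientation≈0⇒Collinear : (∀ x → x ∈ₚ A → orientation p q x ≈ 0#) → Collinear A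
    orientation≈0⇒Collinear flat = - w₂ , w₁ , w₁ * proj₂ p - w₂ * proj₁ p , n≢0 ,
      All.tabulate (λ {x} x∈A → trans (line-equation x) (trans (+-congʳ (flat x (∈⇒∈ₚ x∈A))) (+-identityˡ _)))
      where
      n≢0 : NonZeroDir (- w₂) w₁
      n≢0 (e₁ , e₂) = w≢0 (e₂ , neg≈0⇒≈0 e₁)
      line-equation : ∀ x → lin (- w₂) w₁ x ≈ orientation p q x + (w₁ * proj₂ p - w₂ * proj₁ p)
      line-equation x = solve 6 (λ p₁ p₂ q₁ q₂ x₁ x₂ →
        :- (q₂ :- p₂) :* x₁ :+ (q₁ :- p₁) :* x₂
        := ((q₁ :- p₁) :* (x₂ :- p₂) :- (q₂ :- p₂) :* (x₁ :- p₁)) :+ ((q₁ :- p₁) :* p₂ :- (q₂ :- p₂) :* p₁))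
        refl (proj₁ p) (proj₂ p) (proj₁ q) (proj₂ q) (proj₁ x) (proj₂ x)

    end-sums : List Point
    end-sums = (p +ₚ p) ∷ (p +ₚ q) ∷ (q +ₚ q) ∷ []

    end+end∈end-sums : ∀ {a b} → IsEnd a → IsEnd b → (a +ₚ b) ∈ₚ end-sums
    end+end∈end-sums (inj₁ a≈p) (inj₁ b≈p) = here (+ₚ-cong a≈p b≈p)
    end+end∈end-sums (inj₁ a≈p) (inj₂ b≈q) = there (here (+ₚ-cong a≈p b≈q))
    end+end∈end-sums (inj₂ a≈q) (inj₁ b≈p) = there (here (≈ₚ-trans (+ₚ-cong a≈q b≈p) (+ₚ-comm q p)))
    end+end∈end-sums (inj₂ a≈q) (inj₂ b≈q) = there (there (here (+ₚ-cong a≈q b≈q)))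

    upper-lower-common-sum : ∀ {a b c e} → a ∈ₚ A → b ∈ₚ A → c ∈ₚ A → e ∈ₚ A →
      OnArc 1# a → OnArc 1# b → OnArc (- 1#) c → OnArc (- 1#) e → (a +ₚ b) ≈ₚ (c +ₚ e) → ¬ Collinear A →
      ¬ ¬ ((a +ₚ b) ∈ₚ end-sums)
    upper-lower-common-sum {a} {b} {c} {e} a∈A b∈A c∈A e∈A a-arc b-arc c-arc e-arc a+b≈c+e ¬collinear = do
      0≤Ha ← upper-above a∈A a-arc
      0≤Hb ← upper-above b∈A b-arc
      Hc≤0 ← lower-below c∈A c-arc
      He≤0 ← lower-below e∈A e-arc
      let (Ha≈0 , Hb≈0 , Hc≈0 , He≈0) = nonneg-sum≈nonpos-sum⇒≈0 0≤Ha 0≤Hb Hc≤0 He≤0 (orientation-+ p q a+b≈c+e)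
      yes (a-end , b-end) ← ¬¬-decide (IsEnd a × IsEnd b)
        where no ¬ends-ab → do
          yes (c-end , e-end) ← ¬¬-decide (IsEnd c × IsEnd e)
            where no ¬ends-ce → do
              H≤0 ← ¬¬-map [ upper-flat a∈A a-arc Ha≈0 , upper-flat b∈A b-arc Hb≈0 ]′ (¬¬-de-morgan ¬ends-ab)
              0≤H ← ¬¬-map [ lower-flat c∈A c-arc Hc≈0 , lower-flat e∈A e-arc He≈0 ]′ (¬¬-de-morgan ¬ends-ce)
              contradiction (orientation≈0⇒Collinear (λ x x∈A → antisym (H≤0 x x∈A) (0≤H x x∈A))) ¬collinear
          return (∈ₚ-resp-≈ (≈ₚ-sym a+b≈c+e) (end+end∈end-sums c-end e-end))
      return (end+end∈end-sums a-end b-end)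
      where
      H : Point → Carrier
      H = orientation p q
      upper-above : ∀ {y} → y ∈ₚ A → OnArc 1# y → ¬ ¬ (0# ≤ H y)
      upper-above y∈A y-arc = ¬¬-map (≤-respʳ-≈ (*-identityˡ _)) (Upper.arc-beside-pq y∈A y-arc)
      lower-below : ∀ {y} → y ∈ₚ A → OnArc (- 1#) y → ¬ ¬ (H y ≤ 0#)
      lower-below y∈A y-arc = ¬¬-map 0≤-1*x⇒x≤0 (Lower.arc-beside-pq y∈A y-arc)
      upper-flat : ∀ {y} → y ∈ₚ A → OnArc 1# y → H y ≈ 0# → ¬ IsEnd y → ∀ z → z ∈ₚ A → H z ≤ 0#
      upper-flat y∈A y-arc Hy≈0 ¬end z z∈A =
        ≤-respˡ-≈ (*-identityˡ _) (Upper.interior-on-pq⇒A-beside-pq y∈A y-arc ¬end Hy≈0 z z∈A)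
      lower-flat : ∀ {y} → y ∈ₚ A → OnArc (- 1#) y → H y ≈ 0# → ¬ IsEnd y → ∀ z → z ∈ₚ A → 0# ≤ H z
      lower-flat y∈A y-arc Hy≈0 ¬end z z∈A =
        -1*x≤0⇒0≤x (Lower.interior-on-pq⇒A-beside-pq y∈A y-arc ¬end Hy≈0 z z∈A)

module Diameters {c ℓ₁ ℓ₂ : Level} (F : OrderedField c ℓ₁ ℓ₂) where

  open OrderedFieldProperties F
  open PlaneProperties F
  open Classical
  open import Data.Product using (_×_; _,_; proj₁; proj₂; uncurry)
  open import Data.List using (List; _∷_; cartesianProduct)
  open import Data.List.Relation.Unary.Any using (here)
  open import Data.List.Relation.Unary.All as All using ()
  open import Data.List.Membership.Propositional using (find)
  open import Data.List.Membership.Propositional.Properties using (∈-cartesianProduct⁺; ∈-cartesianProduct⁻)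
  open import Relation.Nullary using (¬_)
  open import Relation.Nullary.Negation using (¬¬-map)

  dist² : Point → Point → Carrier
  dist² x y = (proj₁ y - proj₁ x) * (proj₁ y - proj₁ x) + (proj₂ y - proj₂ x) * (proj₂ y - proj₂ x)

  dist²-cong : ∀ {x x′ y y′} → x ≈ₚ x′ → y ≈ₚ y′ → dist² x y ≈ dist² x′ y′
  dist²-cong {x} {x′} {y} {y′} (e₁ , e₂) (f₁ , f₂) = +-cong (*-cong d₁ d₁) (*-cong d₂ d₂)
    where
    d₁ : proj₁ y - proj₁ x ≈ proj₁ y′ - proj₁ x′
    d₁ = +-cong f₁ (-‿cong e₁)
    d₂ : proj₂ y - proj₂ x ≈ proj₂ y′ - proj₂ x′
    d₂ = +-cong f₂ (-‿cong e₂)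

  dist²-nonneg : ∀ x y → 0# ≤ dist² x y
  dist²-nonneg x y = ≤-respˡ-≈ (+-identityʳ 0#) (+-mono-≤ (square-nonneg _) (square-nonneg _))

  ¬¬-dist²≈0⇒≈ : ∀ {x y} → dist² x y ≈ 0# → ¬ ¬ (x ≈ₚ y)
  ¬¬-dist²≈0⇒≈ d≈0 =
    ¬¬-map (λ (e₁ , e₂) → sym (x-y≈0⇒x≈y _ _ e₁) , sym (x-y≈0⇒x≈y _ _ e₂)) (¬¬-sum-of-squares≈0 d≈0)

  record Diameter (A : List Point) : Set (c ⊔ ℓ₁ ⊔ ℓ₂) where
    field
      p q : Point
      p∈A : p ∈ₚ A
      q∈A : q ∈ₚ A
      maximal : ∀ {x y} → x ∈ₚ A → y ∈ₚ A → dist² x y ≤ dist² p q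

  diameter : ∀ a (A : List Point) → Diameter (a ∷ A)
  diameter a A = record
    { p = proj₁ pq ; q = proj₂ pq
    ; p∈A = proj₁ pq∈A ; q∈A = proj₂ pq∈A
    ; maximal = maximal
    }
    where
    open import Data.List.Extrema totalOrder
      using (argmax; argmax-all; f[xs]≤f[argmax])
    pairs : List (Point × Point)
    pairs = cartesianProduct (a ∷ A) (a ∷ A)
    pq : Point × Point
    pq = argmax (uncurry dist²) (a , a) pairs
    pq∈A : proj₁ pq ∈ₚ (a ∷ A) × proj₂ pq ∈ₚ (a ∷ A)
    pq∈A = argmax-all (uncurry dist²) {P = λ (x , y) → x ∈ₚ (a ∷ A) × y ∈ₚ (a ∷ A)}
      (here ≈ₚ-refl , here ≈ₚ-refl)
      (All.tabulate (λ xy∈pairs → let (x∈ , y∈) = ∈-cartesianProduct⁻ (a ∷ A) (a ∷ A) xy∈pairs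
                                  in ∈⇒∈ₚ x∈ , ∈⇒∈ₚ y∈))
    maximal : ∀ {x y} → x ∈ₚ (a ∷ A) → y ∈ₚ (a ∷ A) → dist² x y ≤ dist² (proj₁ pq) (proj₂ pq)
    maximal x∈A y∈A =
      let (x′ , x′∈A , x≈x′) = find x∈A
          (y′ , y′∈A , y≈y′) = find y∈A
      in ≤-respˡ-≈ (sym (dist²-cong x≈x′ y≈y′))
           (All.lookup (f[xs]≤f[argmax] {f = uncurry dist²} (a , a) pairs) (∈-cartesianProduct⁺ x′∈A y′∈A))

  diameter-extremal : ∀ {A} (D : Diameter A) → ¬ Collinear A → DiameterFrame.Extremal F A (Diameter.p D) (Diameter.q D)
  diameter-extremal {A} D ¬collinear = record
    { p∈A = p∈A
    ; q∈A = q∈A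
    ; ‖w‖²>0 = ‖w‖²>0
    ; p-unique-min = p-unique-min
    ; q-unique-max = q-unique-max
    }
    where
    open Diameter D
    open DiameterFrame F A p q using (G; ‖w‖²)
    open import Data.Integer.Base using (+_)
    -- Each `cosines` below is the law of cosines in the triangle p q x; with dist² ≤ dist² p q = ‖w‖² it pins x to q or p.
    squares-vanish : ∀ {d t} → 0# ≤ d → 0# ≤ t → (d + (t + t)) + ‖w‖² ≤ ‖w‖² → d ≈ 0#
    squares-vanish {d} {t} 0≤d 0≤t le =
      proj₁ (nonneg-+≈0 0≤d 0≤2t (antisym d+2t≤0 (≤-respˡ-≈ (+-identityʳ 0#) (+-mono-≤ 0≤d 0≤2t))))
      where
      0≤2t : 0# ≤ t + t
      0≤2t = ≤-respˡ-≈ (+-identityʳ 0#) (+-mono-≤ 0≤t 0≤t)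
      d+2t≤0 : d + (t + t) ≤ 0#
      d+2t≤0 = +-cancelˡ-≤ (≤-respʳ-≈ (sym (+-identityʳ ‖w‖²)) (≤-respˡ-≈ (+-comm _ ‖w‖²) le))
    q-unique-max : ∀ x → x ∈ₚ A → G q ≤ G x → ¬ ¬ (x ≈ₚ q)
    q-unique-max x x∈A q≤x = ¬¬-map ≈ₚ-sym (¬¬-dist²≈0⇒≈ (squares-vanish (dist²-nonneg q x) (x≤y⇒0≤y-x q≤x)
      (≤-respˡ-≈ cosines (maximal p∈A x∈A))))
      where
      cosines : dist² p x ≈ (dist² q x + ((G x - G q) + (G x - G q))) + ‖w‖²
      cosines = solve 6 (λ p₁ p₂ q₁ q₂ x₁ x₂ →
        (x₁ :- p₁) :* (x₁ :- p₁) :+ (x₂ :- p₂) :* (x₂ :- p₂)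
        := ((x₁ :- q₁) :* (x₁ :- q₁) :+ (x₂ :- q₂) :* (x₂ :- q₂)) :+
           ((((q₁ :- p₁) :* x₁ :+ (q₂ :- p₂) :* x₂) :- ((q₁ :- p₁) :* q₁ :+ (q₂ :- p₂) :* q₂)) :+
            (((q₁ :- p₁) :* x₁ :+ (q₂ :- p₂) :* x₂) :- ((q₁ :- p₁) :* q₁ :+ (q₂ :- p₂) :* q₂))) :+
           ((q₁ :- p₁) :* (q₁ :- p₁) :+ (q₂ :- p₂) :* (q₂ :- p₂)))
        refl (proj₁ p) (proj₂ p) (proj₁ q) (proj₂ q) (proj₁ x) (proj₂ x)
    p-unique-min : ∀ x → x ∈ₚ A → G x ≤ G p → ¬ ¬ (x ≈ₚ p)
    p-unique-min x x∈A x≤p = ¬¬-dist²≈0⇒≈ (squares-vanish (dist²-nonneg x p) (x≤y⇒0≤y-x x≤p)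
      (≤-respˡ-≈ cosines (maximal x∈A q∈A)))
      where
      cosines : dist² x q ≈ (dist² x p + ((G p - G x) + (G p - G x))) + ‖w‖²
      cosines = solve 6 (λ p₁ p₂ q₁ q₂ x₁ x₂ →
        (q₁ :- x₁) :* (q₁ :- x₁) :+ (q₂ :- x₂) :* (q₂ :- x₂)
        := ((p₁ :- x₁) :* (p₁ :- x₁) :+ (p₂ :- x₂) :* (p₂ :- x₂)) :+
           ((((q₁ :- p₁) :* p₁ :+ (q₂ :- p₂) :* p₂) :- ((q₁ :- p₁) :* x₁ :+ (q₂ :- p₂) :* x₂)) :+
            (((q₁ :- p₁) :* p₁ :+ (q₂ :- p₂) :* p₂) :- ((q₁ :- p₁) :* x₁ :+ (q₂ :- p₂) :* x₂))) :+
           ((q₁ :- p₁) :* (q₁ :- p₁) :+ (q₂ :- p₂) :* (q₂ :- p₂)))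
        refl (proj₁ p) (proj₂ p) (proj₁ q) (proj₂ q) (proj₁ x) (proj₂ x)
    ‖w‖²>0 : 0# < ‖w‖²
    ‖w‖²>0 ‖w‖²≤0 = ¬¬-all A (λ x x∈A → same-abscissa (∈⇒∈ₚ x∈A))
      (λ on-line → ¬collinear (1# , 0# , proj₁ p , e₁≢0 , on-line))
      where
      e₁≢0 : NonZeroDir 1# 0#
      e₁≢0 (1≈0 , _) = 0≉1 (sym 1≈0)
      same-abscissa : ∀ {x} → x ∈ₚ A → ¬ ¬ (lin 1# 0# x ≈ proj₁ p)
      same-abscissa {x} x∈A = ¬¬-map (λ (e₁ , _) → trans (trans (+-cong (*-identityˡ _) (zeroˡ _)) (+-identityʳ _)) (sym e₁))
        (¬¬-dist²≈0⇒≈ (antisym (≤-trans (maximal p∈A x∈A) ‖w‖²≤0) (dist²-nonneg p x)))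

module ChainSums {c ℓ₁ ℓ₂ : Level} (F : OrderedField c ℓ₁ ℓ₂) where

  open import Data.Nat using (ℕ; zero; suc; _+_; _*_; _∸_; _≤_; _<_)
  open import Data.Product using (Σ-syntax; ∃-syntax; _×_; _,_; proj₁; proj₂)

  open OrderedFieldProperties F using (Carrier; _≈_) renaming (_+_ to _+F_; _≤_ to _≤F_; _<_ to _<F_)
  open PlaneProperties F using (Point; _+ₚ_; _≈ₚ_)

  module Count
    (G : Point → Carrier) (G-+ : ∀ a b → G (a +ₚ b) ≈ G a +F G b) (G-cong : ∀ {a b} → a ≈ₚ b → G a ≈ G b)
    (n : ℕ) (z : ℕ → Point) (m₀ : ℕ)
    {ℓL ℓO : Level} (Line : Set ℓL) (On : Line → Point → Set ℓO)
    (G-increasing : ∀ {i j} → i < j → j < n → G (z i) <F G (z j))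
    (equal-sums⇒straight : ∀ {i i′ j′ j} → i < i′ → i′ ≤ j′ → j′ < j → j < n →
      (z i +ₚ z j) ≈ₚ (z i′ +ₚ z j′) →
      ¬ ¬ (Σ[ ℓ ∈ Line ] ∀ t → i ≤ t → t ≤ j → On ℓ (z t)))
    (straight-short : ∀ {i j} (ℓ : Line) → i < j → j < n → (∀ t → i ≤ t → t ≤ j → On ℓ (z t)) →
      ¬ ¬ (suc (j ∸ i) ≤ 2 + m₀))
    (lines-agree : ∀ {t} (ℓ ℓ′ : Line) x → suc t < n →
      On ℓ (z t) → On ℓ (z (suc t)) → On ℓ′ (z t) → On ℓ′ (z (suc t)) →
      On ℓ x → ¬ ¬ On ℓ′ x)
    where

    open OrderedFieldProperties F using (≤-reflexive; <⇒≤; +-mono-≤-<; +-mono-<-≤; trans; sym)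
      renaming (≤-refl to ≤F-refl)
    open PlaneProperties F using (Distinct; _∈ₚ_; ∈ₚ-resp-≈; ∈⇒∈ₚ; ≈ₚ-refl; ≈ₚ-sym; ≈ₚ-trans; +ₚ-comm)
    import Data.Nat.Properties as ℕ
    open import Data.Nat using (z≤n; s≤s; _≤?_; _<?_)
    open import Data.Sum using (inj₁; inj₂)
    open import Data.List using (List; []; _∷_; _++_; length; map; upTo)
    open import Data.List.Properties using (length-++; length-map)
    open import Data.List.Relation.Unary.All as All using (All; []; _∷_)
    import Data.List.Relation.Unary.All.Properties as All
    open import Data.List.Relation.Unary.AllPairs using ([]; _∷_)
    import Data.List.Relation.Unary.AllPairs.Properties as AllPairs
    open import Data.List.Membership.Propositional.Properties using (∈-upTo⁻)
    open import Relation.Nullary using (contradiction; yes; no)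
    open import Relation.Nullary.Decidable using (decidable-stable; _×-dec_)
    open import Relation.Binary.PropositionalEquality as ≡ using (_≡_; cong; subst)
    open Classical
    open import Relation.Nullary.Negation using (¬¬-map)
    open CountingArithmetic using (invariant-extend; invariant-restart)

    Straight : ℕ → ℕ → Set (ℓL ⊔ ℓO)
    Straight a b = Σ[ ℓ ∈ Line ] ∀ t → a ≤ t → t ≤ b → On ℓ (z t)

    straight-mono : ∀ {a b a′ b′} → a ≤ a′ → b′ ≤ b → Straight a b → Straight a′ b′
    straight-mono a≤a′ b′≤b (ℓ , on) =
      ℓ , λ t a′≤t t≤b′ → on t (ℕ.≤-trans a≤a′ a′≤t) (ℕ.≤-trans t≤b′ b′≤b)

    straight-glue : ∀ {a b K} → a < K → b < K → suc K < n → Straight a (suc K) → Straight b K → ¬ ¬ Straight b (suc K)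
    straight-glue {a} {b} {suc K} (s≤s a≤K) (s≤s b≤K) k<n (ℓ , on) (ℓ′ , on′) = do
      on′-last ← lines-agree {t = K} ℓ ℓ′ (z (suc (suc K))) (ℕ.<-trans (ℕ.n<1+n (suc K)) k<n)
        (on K a≤K (ℕ.≤-trans (ℕ.n≤1+n K) (ℕ.n≤1+n (suc K)))) (on (suc K) (ℕ.m≤n⇒m≤1+n a≤K) (ℕ.n≤1+n (suc K)))
        (on′ K b≤K (ℕ.n≤1+n K)) (on′ (suc K) (ℕ.m≤n⇒m≤1+n b≤K) ℕ.≤-refl)
        (on (suc (suc K)) (ℕ.m≤n⇒m≤1+n (ℕ.m≤n⇒m≤1+n a≤K)) ℕ.≤-refl)
      return (ℓ′ , λ t b≤t t≤k →
        [ (λ t<k → on′ t b≤t (ℕ.≤-pred t<k)) , (λ { ≡.refl → on′-last }) ]′ (ℕ.m≤n⇒m<n∨m≡n t≤k))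
      where open import Data.Sum using ([_,_]′)

    G-nondecreasing : ∀ {i j} → i ≤ j → j < n → G (z i) ≤F G (z j)
    G-nondecreasing {i} {j} i≤j j<n with ℕ.m≤n⇒m<n∨m≡n i≤j
    ... | inj₁ i<j = <⇒≤ (G-increasing i<j j<n)
    ... | inj₂ ≡.refl = ≤F-refl

    IsSum : ℕ → Point → Set ℓ₁
    IsSum K x = ∃[ i ] ∃[ j ] (i ≤ K × j ≤ K × x ≈ₚ (z i +ₚ z j))

    -- Besides the distinct sums of z 0 … z K, the state records the longest straight run z start … z K;
    -- the term r t of the bound is a reserve for the collisions that a longer run may still cause.
    record SumCount (K : ℕ) : Set (c ⊔ ℓ₁ ⊔ ℓ₂ ⊔ ℓL ⊔ ℓO) where
      field
        sums : List Point
        distinct : Distinct sums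
        sound : All (IsSum K) sums
        start r t : ℕ
        start+r≡K : start + r ≡ K
        r+t+1≡m₀+2 : r + suc t ≡ suc (suc m₀)
        straight : start < K → Straight start K
        longest : ∀ s → s < start → ¬ Straight s K
        bound : suc K * suc (suc K) + r * t ≤ 2 * length sums + K * m₀

    initial : SumCount 0
    initial = record
      { sums = (z 0 +ₚ z 0) ∷ []
      ; distinct = [] ∷ []
      ; sound = (0 , 0 , z≤n , z≤n , ≈ₚ-refl) ∷ []
      ; start = 0 ; r = 0 ; t = suc m₀
      ; start+r≡K = ≡.refl ; r+t+1≡m₀+2 = ≡.refl
      ; straight = λ ()
      ; longest = λ _ ()
      ; bound = ℕ.≤-refl
      }

    module Step (K : ℕ) (k<n : suc K < n) (st : SumCount K) where

      open SumCount st

      k : ℕ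
      k = suc K

      start≤K : start ≤ K
      start≤K = subst (start ≤_) start+r≡K (ℕ.m≤m+n start r)

      f : ℕ → Point
      f i = z i +ₚ z k

      Fresh : ℕ → Set (c ⊔ ℓ₁)
      Fresh i = ¬ (f i ∈ₚ sums)

      f-injective : ∀ {i j} → i < j → j < suc k → ¬ (f i ≈ₚ f j)
      f-injective i<j j≤k fi≈fj = +-mono-<-≤ (G-increasing i<j (ℕ.≤-<-trans (ℕ.≤-pred j≤k) k<n)) ≤F-refl
        (≤-reflexive (trans (sym (G-+ _ _)) (trans (G-cong (≈ₚ-sym fi≈fj)) (G-+ _ _))))

      -- z i + z k = z a + z b with a ≤ b ≤ K forces i < a, so the indices are nested as needed for a straight run.
      equal-sum⇒straight : ∀ {i a b} → i < suc k → a ≤ b → b ≤ K → f i ≈ₚ (z a +ₚ z b) → ¬ ¬ (i < K × Straight i k)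
      equal-sum⇒straight {i} {a} {b} i≤k a≤b b≤K fi≈ =
        ¬¬-map (ℕ.<-≤-trans i<a (ℕ.≤-trans a≤b b≤K) ,_) (equal-sums⇒straight i<a a≤b (s≤s b≤K) k<n fi≈)
        where
        i<a : i < a
        i<a with a ≤? i
        ... | no a≰i = ℕ.≰⇒> a≰i
        ... | yes a≤i = contradiction
              (≤-reflexive (trans (sym (G-+ (z i) (z k))) (trans (G-cong fi≈) (G-+ (z a) (z b)))))
              (+-mono-≤-< (G-nondecreasing a≤i (ℕ.≤-<-trans (ℕ.≤-pred i≤k) k<n)) (G-increasing (s≤s b≤K) k<n))

      collision⇒straight : ∀ {i} → i < suc k → f i ∈ₚ sums → ¬ ¬ (i < K × Straight i k)
      collision⇒straight {i} i≤k fi∈sums with All.lookupAny sound fi∈sums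
      ... | (a , b , a≤K , b≤K , y≈) , fi≈y with ℕ.≤-total a b
      ...   | inj₁ a≤b = equal-sum⇒straight i≤k a≤b b≤K (≈ₚ-trans fi≈y y≈)
      ...   | inj₂ b≤a = equal-sum⇒straight i≤k b≤a a≤K (≈ₚ-trans fi≈y (≈ₚ-trans y≈ (+ₚ-comm (z a) (z b))))

      module Extension (ds : Selection.Decisions {P = Fresh} (upTo (suc k))) where

        open Selection {P = Fresh} using (accepted; accepted-All; accepted⁺; accepted-AllPairs)
        open IndexCounting {P = Fresh} using (length-accepted-upTo)

        fresh : List ℕ
        fresh = accepted ds

        sums′ : List Point
        sums′ = sums ++ map f fresh

        sums′-distinct : Distinct sums′
        sums′-distinct = AllPairs.++⁺ distinct
          (AllPairs.map⁺ (accepted-AllPairs ds (AllPairs.applyUpTo⁺₁ (λ i → i) (suc k) f-injective)))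
          (All.tabulate (λ x∈sums → All.map⁺ (All.map (λ fresh-i x≈fi → fresh-i (∈ₚ-resp-≈ x≈fi (∈⇒∈ₚ x∈sums)))
                                                       (accepted-All ds))))

        sums′-sound : All (IsSum k) sums′
        sums′-sound = All.++⁺
          (All.map (λ (i , j , i≤K , j≤K , e) → i , j , ℕ.m≤n⇒m≤1+n i≤K , ℕ.m≤n⇒m≤1+n j≤K , e) sound)
          (All.map⁺ (All.map (λ i≤k → _ , k , ℕ.≤-pred i≤k , ℕ.≤-refl , ≈ₚ-refl) (accepted⁺ ds (All.tabulate ∈-upTo⁻))))

        length-sums′ : length sums′ ≡ length sums + length fresh
        length-sums′ = ≡.trans (length-++ sums) (cong (length sums +_) (length-map f fresh))

        fresh-count : ∀ lo c → (∀ i → i < suc k → ¬ Fresh i → ¬ ¬ (lo ≤ i × i < lo + c)) → suc k ≤ length fresh + c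
        fresh-count lo c stale-in-interval = length-accepted-upTo (suc k) lo c ds
          (λ i i≤k stale → decidable-stable ((lo ≤? i) ×-dec (suc i ≤? lo + c)) (stale-in-interval i i≤k stale))

        next-count : ∀ start′ r′ t′ → start′ + r′ ≡ k → r′ + suc t′ ≡ suc (suc m₀) →
          (start′ < k → Straight start′ k) → (∀ s → s < start′ → ¬ Straight s k) →
          suc k * suc (suc k) + r′ * t′ ≤ 2 * (length sums + length fresh) + k * m₀ → SumCount k
        next-count start′ r′ t′ start′+r′≡k r′+t′+1≡m₀+2 straight′ longest′ bound′ = record
          { sums = sums′ ; distinct = sums′-distinct ; sound = sums′-sound
          ; start = start′ ; r = r′ ; t = t′
          ; start+r≡K = start′+r′≡k ; r+t+1≡m₀+2 = r′+t′+1≡m₀+2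
          ; straight = straight′ ; longest = longest′
          ; bound = subst (λ L → suc k * suc (suc k) + r′ * t′ ≤ 2 * L + k * m₀) (≡.sym length-sums′) bound′
          }

        extended-run : Straight start k → ¬ ¬ SumCount k
        extended-run run = do
          short ← straight-short (proj₁ run) (s≤s start≤K) k<n (proj₂ run)
          let (t′ , t≡1+t′) = positive t r+t+1≡m₀+2 (subst (λ x → suc x ≤ 2 + m₀) k∸start≡1+r short)
          return (next-count start (suc r) t′
            (≡.trans (ℕ.+-suc start r) (cong suc start+r≡K))
            (≡.trans (≡.sym (ℕ.+-suc r (suc t′))) (subst (λ t → r + suc t ≡ suc (suc m₀)) t≡1+t′ r+t+1≡m₀+2))
            (λ _ → run)
            (λ s s<start run′ → longest s s<start (straight-mono ℕ.≤-refl (ℕ.n≤1+n K) run′))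
            (invariant-extend K r t′ m₀ (length sums) (length fresh)
              (subst (λ t → r + suc t ≡ suc (suc m₀)) t≡1+t′ r+t+1≡m₀+2)
              (subst (λ t → suc K * suc (suc K) + r * t ≤ 2 * length sums + K * m₀) t≡1+t′ bound)
              (fresh-count start r stale-in-run)))
          where
          k∸start≡1+r : k ∸ start ≡ suc r
          k∸start≡1+r = ≡.trans (cong (λ x → suc x ∸ start) (≡.sym start+r≡K))
                          (≡.trans (cong (_∸ start) (≡.sym (ℕ.+-suc start r))) (ℕ.m+n∸m≡n start (suc r)))
          positive : ∀ t → r + suc t ≡ suc (suc m₀) → suc (suc r) ≤ 2 + m₀ → ∃[ t′ ] t ≡ suc t′
          positive (suc t′) _ _ = t′ , ≡.refl
          positive zero r+1≡m₀+2 r+2≤m₀+2 = contradiction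
            (ℕ.≤-trans (subst (suc (suc r) ≤_) (≡.sym r+1≡m₀+2) r+2≤m₀+2) (ℕ.≤-reflexive (ℕ.+-comm r 1)))
            (ℕ.<-irrefl ≡.refl)
          stale-in-run : ∀ i → i < suc k → ¬ Fresh i → ¬ ¬ (start ≤ i × i < start + r)
          stale-in-run i i≤k stale = do
            fi∈sums ← stale
            (i<K , run′) ← collision⇒straight i≤k fi∈sums
            return (start≤i i<K run′ , subst (i <_) (≡.sym start+r≡K) i<K)
            where
            start≤i : i < K → Straight i k → start ≤ i
            start≤i i<K run′ with start ≤? i
            ... | yes start≤i = start≤i
            ... | no start≰i = contradiction (straight-mono ℕ.≤-refl (ℕ.n≤1+n K) run′) (longest i (ℕ.≰⇒> start≰i))

        broken-run : ¬ Straight start k → ¬ ¬ SumCount k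
        broken-run ¬run = do
          yes last-pair ← ¬¬-decide (Straight K k)
            where no ¬last-pair → return (next-count k 0 (suc m₀) (ℕ.+-identityʳ k) ≡.refl
                    (λ k<k → contradiction k<k (ℕ.<-irrefl ≡.refl))
                    (λ s s<k run′ → ¬last-pair (straight-mono (ℕ.≤-pred s<k) ℕ.≤-refl run′))
                    (invariant-restart K r t m₀ (length sums) (length fresh) 0 (suc m₀) bound all-fresh z≤n))
          return (next-count K 1 m₀ (ℕ.+-comm K 1) ≡.refl (λ _ → last-pair) no-longer-run
            (invariant-restart K r t m₀ (length sums) (length fresh) 1 m₀ bound all-fresh (ℕ.≤-reflexive (ℕ.*-identityˡ m₀))))
          where
          no-run-into-k : ∀ {i} → i < K → ¬ Straight i k
          no-run-into-k {i} i<K run′ with i ≤? start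
          ... | yes i≤start = ¬run (straight-mono i≤start ℕ.≤-refl run′)
          ... | no i≰start = straight-glue i<K start<K k<n run′ (straight start<K) ¬run
            where
            start<K : start < K
            start<K = ℕ.<-trans (ℕ.≰⇒> i≰start) i<K
          all-fresh : suc k ≤ length fresh
          all-fresh = subst (suc k ≤_) (ℕ.+-identityʳ _) (fresh-count 0 0 (λ i i≤k stale _ → stale (λ fi∈sums →
            collision⇒straight i≤k fi∈sums (λ (i<K , run′) → no-run-into-k i<K run′))))
          no-longer-run : ∀ s → s < K → ¬ Straight s k
          no-longer-run s s<K run′ with start <? K
          ... | yes start<K = straight-glue s<K start<K k<n run′ (straight start<K) ¬run
          ... | no start≮K = longest s (subst (s <_) (ℕ.≤-antisym (ℕ.≮⇒≥ start≮K) start≤K) s<K)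
                  (straight-mono ℕ.≤-refl (ℕ.n≤1+n K) run′)

        next : ¬ ¬ SumCount k
        next = do
          yes run ← ¬¬-decide (Straight start k)
            where no ¬run → broken-run ¬run
          extended-run run

    sum-count : ∀ K → K < n → ¬ ¬ SumCount K
    sum-count zero _ = return initial
    sum-count (suc K) k<n = do
      st ← sum-count K (ℕ.<-trans (ℕ.n<1+n K) k<n)
      ds ← ¬¬-decide-all (upTo (suc (suc K)))
      Step.Extension.next K k<n st ds

    chain-sums : ∀ K → suc K ≡ n →
      ¬ ¬ (Σ[ S ∈ List Point ] (Distinct S × All (IsSum K) S × suc K * suc (suc K) ≤ 2 * length S + K * m₀))
    chain-sums K K+1≡n = ¬¬-map (λ st → let open SumCount st in sums , distinct , sound , ℕ.≤-trans (ℕ.m≤m+n _ _) bound)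
      (sum-count K (subst (K <_) K+1≡n ℕ.≤-refl))

module ArcChains {c ℓ₁ ℓ₂ : Level} (F : OrderedField c ℓ₁ ℓ₂)
  (A : List (Plane.Point F)) (A-distinct : Plane.Distinct F A) (p q : Plane.Point F)
  (ext : DiameterFrame.Extremal F A p q) (m : ℕ) (max-side : Plane.MaxSideSize F A m) where

  open import Data.List using ([]; _∷_; _++_; length; applyUpTo)
  open import Data.Nat using (suc; _+_; _*_; _∸_; _≤_; _<_; z≤n; s≤s)
  open import Data.Product using (Σ-syntax; _×_; _,_; proj₁; proj₂)
  open OrderedFieldProperties F renaming (_≤_ to _≤F_; _<_ to _<F_; _+_ to _+F_; _*_ to _*F_)
  open PlaneProperties F
  open DiameterFrame F A p q
  open Arcs ext
  open Extremal ext
  open Classical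
  import Data.Nat.Properties as ℕ
  open import Data.Sum using (inj₁; inj₂)
  open import Data.List.Properties using (length-applyUpTo; length-++)
  open import Data.List.Relation.Unary.Any as Any using (here; there)
  open import Data.List.Relation.Unary.All as All using (All; []; _∷_)
  import Data.List.Relation.Unary.All.Properties as All
  open import Data.List.Relation.Unary.AllPairs as AllPairs using (AllPairs; []; _∷_)
  import Data.List.Relation.Unary.AllPairs.Properties as AllPairs
  open import Data.List.Membership.Propositional using (_∈_; find)
  open import Data.List.Membership.Propositional.Properties using (∈-applyUpTo⁻)
  open import Relation.Nullary using (contradiction)
  open import Relation.Nullary.Negation using (¬¬-map)
  open import Relation.Binary.PropositionalEquality as ≡ using (_≡_; cong; subst; subst₂)
  open SetoidPigeonhole pointSetoid using (Unique∧⊆⇒length≤)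

  m₀ : ℕ
  m₀ = m ∸ 2

  2+m₀≡m : 2 + m₀ ≡ m
  2+m₀≡m = let ((_ , _ , _ , _ , _ , 2≤m) , _) = max-side in ℕ.m+[n∸m]≡n 2≤m

  side-bound : ∀ k → SideSize A k → k ≤ 2 + m₀
  side-bound k side = subst (k ≤_) (≡.sym 2+m₀≡m) (proj₂ max-side k side)

  SupportingLine : Set (c ⊔ ℓ₁ ⊔ ℓ₂)
  SupportingLine = Σ[ u ∈ Carrier ] Σ[ v ∈ Carrier ] Σ[ k ∈ Carrier ] IsSupporting A u v k

  OnLine : SupportingLine → Point → Set ℓ₁
  OnLine (u , v , k , _) x = ¬ ¬ (lin u v x ≈ k)

  -- Two or more points of A on a supporting line span a side of [A].
  on-supporting-line-≤ : ∀ (ℓ : SupportingLine) {ys} → Distinct ys → 2 ≤ length ys →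
    All (λ y → y ∈ₚ A × OnLine ℓ y) ys → ¬ ¬ (length ys ≤ 2 + m₀)
  on-supporting-line-≤ (u , v , k , supporting) {ys} ys-distinct 2≤ys on = do
    ds ← ¬¬-decide-all A
    ys-on ← ¬¬-sequence (All.map (λ (y∈A , ¬¬on) → ¬¬-map (y∈A ,_) ¬¬on) on)
    let side = Selection.accepted ds
        ys⊆side = All.map (λ (y∈A , y-on) → ∈-side ds y∈A y-on) ys-on
        ys≤side = Unique∧⊆⇒length≤ ys-distinct ys⊆side
    return (ℕ.≤-trans ys≤side (side-bound (length side)
      (u , v , k , supporting , side-card ds , ℕ.≤-trans 2≤ys ys≤side)))
    where
    open Selection {P = λ a → lin u v a ≈ k}
    ∈-side : ∀ ds {x} → x ∈ₚ A → lin u v x ≈ k → x ∈ₚ accepted ds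
    ∈-side ds x∈A φx≈k = accepted-Any ds (Any.map (λ x≈a → x≈a , trans (sym (lin-cong u v x≈a)) φx≈k) x∈A)
    side-card : ∀ ds → CardIs (λ x → x ∈ₚ A × lin u v x ≈ k) (length (accepted ds))
    side-card ds = accepted ds , accepted-AllPairs ds A-distinct , sound , (λ x (x∈A , φx≈k) → ∈-side ds x∈A φx≈k) , ≡.refl
      where
      sound : ∀ x → x ∈ₚ accepted ds → x ∈ₚ A × lin u v x ≈ k
      sound x x∈side with find x∈side
      ... | a , a∈side , x≈a = ∈ₚ-resp-≈ (≈ₚ-sym x≈a) (All.lookup (accepted⁺ ds (All.tabulate ∈⇒∈ₚ)) a∈side) ,
                               trans (lin-cong u v x≈a) (All.lookup (accepted-All ds) a∈side)

  ArcInterior : Carrier → Point → Set (c ⊔ ℓ₁ ⊔ ℓ₂)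
  ArcInterior σ y = y ∈ₚ A × OnOpenArc σ y × ¬ IsEnd y

  ArcSum : Carrier → Point → Set (c ⊔ ℓ₁ ⊔ ℓ₂)
  ArcSum σ x = Σ[ a ∈ Point ] Σ[ b ∈ Point ] (a ∈ₚ A × b ∈ₚ A × OnArc σ a × OnArc σ b × x ≈ₚ (a +ₚ b))

  module ArcChain (σ : Carrier) (σ²≈1 : σ *F σ ≈ 1#) (Z : List Point)
    (Z-on-arc : All (λ y → y ∈ₚ A × OnArc σ y) Z) (Z-increasing : AllPairs (λ a b → G a <F G b) Z) where

    open Side σ σ²≈1
    open ListExtras using (lookupOr; All-lookupOr; AllPairs-lookupOr)

    n : ℕ
    n = length Z

    z : ℕ → Point
    z = lookupOr p Z

    z∈A : ∀ {i} → i < n → z i ∈ₚ A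
    z∈A i<n = proj₁ (All-lookupOr Z-on-arc i<n)

    z-on-arc : ∀ {i} → i < n → OnArc σ (z i)
    z-on-arc i<n = proj₂ (All-lookupOr Z-on-arc i<n)

    G-increasing : ∀ {i j} → i < j → j < n → G (z i) <F G (z j)
    G-increasing = AllPairs-lookupOr Z-increasing

    G-nondecreasing : ∀ {i j} → i ≤ j → j < n → G (z i) ≤F G (z j)
    G-nondecreasing {i} {j} i≤j j<n with ℕ.m≤n⇒m<n∨m≡n i≤j
    ... | inj₁ i<j = <⇒≤ (G-increasing i<j j<n)
    ... | inj₂ ≡.refl = ≤-refl

    equal-sums⇒straight : ∀ {i i′ j′ j} → i < i′ → i′ ≤ j′ → j′ < j → j < n →
      (z i +ₚ z j) ≈ₚ (z i′ +ₚ z j′) →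
      ¬ ¬ (Σ[ ℓ ∈ SupportingLine ] ∀ t → i ≤ t → t ≤ j → OnLine ℓ (z t))
    equal-sums⇒straight {i} {i′} {j′} {j} i<i′ i′≤j′ j′<j j<n sums≈ = do
      (u , v , k , supporting , straight) ←
        equal-sums⇒straight-arc (z∈A i<n) (z∈A j<n) (z∈A j′<n) (z-on-arc i′<n) (z-on-arc j′<n)
          (G-increasing i<i′ i′<n) (G-nondecreasing i′≤j′ j′<n) (G-increasing j′<j j<n) (≈ₚ-sym sums≈)
      return ((u , v , k , supporting) , λ t i≤t t≤j → let t<n = ℕ.≤-<-trans t≤j j<n in
        straight (z t) (z∈A t<n) (z-on-arc t<n) (G-nondecreasing i≤t t<n) (G-nondecreasing t≤j j<n))
      where
      j′<n : j′ < n
      j′<n = ℕ.<-trans j′<j j<n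
      i′<n : i′ < n
      i′<n = ℕ.≤-<-trans i′≤j′ j′<n
      i<n : i < n
      i<n = ℕ.<-trans i<i′ i′<n

    straight-short : ∀ {i j} (ℓ : SupportingLine) → i < j → j < n → (∀ t → i ≤ t → t ≤ j → OnLine ℓ (z t)) →
      ¬ ¬ (suc (j ∸ i) ≤ 2 + m₀)
    straight-short {i} {j} ℓ i<j j<n on =
      ¬¬-map (subst (_≤ 2 + m₀) (length-applyUpTo run (suc (j ∸ i))))
        (on-supporting-line-≤ ℓ run-distinct
          (subst (2 ≤_) (≡.sym (length-applyUpTo run (suc (j ∸ i)))) (s≤s (ℕ.m<n⇒0<n∸m i<j)))
          (All.tabulate on-run))
      where
      run : ℕ → Point
      run t = z (i + t)
      index≤j : ∀ {t} → t < suc (j ∸ i) → i + t ≤ j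
      index≤j {t} t≤j∸i = subst (i + t ≤_) (ℕ.m+[n∸m]≡n (ℕ.<⇒≤ i<j)) (ℕ.+-monoʳ-≤ i (ℕ.≤-pred t≤j∸i))
      index<n : ∀ {t} → t < suc (j ∸ i) → i + t < n
      index<n t≤j∸i = ℕ.≤-<-trans (index≤j t≤j∸i) j<n
      on-run : ∀ {y} → y ∈ applyUpTo run (suc (j ∸ i)) → y ∈ₚ A × OnLine ℓ y
      on-run y∈run with ∈-applyUpTo⁻ run y∈run
      ... | t , t≤j∸i , ≡.refl = z∈A (index<n t≤j∸i) , on (i + t) (ℕ.m≤m+n i t) (index≤j t≤j∸i)
      run-distinct : Distinct (applyUpTo run (suc (j ∸ i)))
      run-distinct = AllPairs.applyUpTo⁺₁ run (suc (j ∸ i)) (λ a<b b≤j∸i run-a≈run-b →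
        G-increasing (ℕ.+-monoʳ-< i a<b) (index<n b≤j∸i) (≤-reflexive (lin-cong w₁ w₂ (≈ₚ-sym run-a≈run-b))))

    lines-agree : ∀ {t} (ℓ ℓ′ : SupportingLine) x → suc t < n → OnLine ℓ (z t) → OnLine ℓ (z (suc t)) →
      OnLine ℓ′ (z t) → OnLine ℓ′ (z (suc t)) → OnLine ℓ x → ¬ ¬ OnLine ℓ′ x
    lines-agree {t} (u , v , k , (n≢0 , _)) (u′ , v′ , k′ , _) x t+1<n on₁ on₂ on₃ on₄ on₅ = return (do
      e₁ ← on₁
      e₂ ← on₂
      e₃ ← on₃
      e₄ ← on₄
      e₅ ← on₅
      ¬¬-lines-through-two-points-agree n≢0 zt≉zt+1 e₁ e₂ e₃ e₄ e₅)
      where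
      zt≉zt+1 : ¬ (z t ≈ₚ z (suc t))
      zt≉zt+1 zt≈zt+1 = G-increasing (ℕ.n<1+n t) t+1<n (≤-reflexive (lin-cong w₁ w₂ (≈ₚ-sym zt≈zt+1)))

    open ChainSums.Count F G (lin-+ w₁ w₂) (lin-cong w₁ w₂) n z m₀ SupportingLine OnLine
      G-increasing equal-sums⇒straight straight-short lines-agree public using (chain-sums; IsSum)

    IsSum⇒ArcSum : ∀ {K x} → suc K ≡ n → IsSum K x → ArcSum σ x
    IsSum⇒ArcSum {K} K+1≡n (i , j , i≤K , j≤K , x≈) =
      z i , z j , z∈A (below i≤K) , z∈A (below j≤K) , z-on-arc (below i≤K) , z-on-arc (below j≤K) , x≈
      where
      below : ∀ {i} → i ≤ K → i < n
      below i≤K = subst (_ <_) K+1≡n (s≤s i≤K)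

  arc-sums : ∀ σ (σ²≈1 : σ *F σ ≈ 1#) (X : List Point) → All (ArcInterior σ) X → Distinct X →
    ¬ ¬ (Σ[ S ∈ List Point ] (Distinct S × All (ArcSum σ) S ×
      suc (suc (length X)) * suc (suc (suc (length X))) ≤ 2 * length S + suc (length X) * m₀))
  arc-sums σ σ²≈1 X X-interior X-distinct =
    ¬¬-map (λ (S , S-distinct , S-sums , bound) → S , S-distinct , All.map (IsSum⇒ArcSum length-Z) S-sums , bound)
      (chain-sums (suc (length X)) length-Z)
    where
    open Side σ σ²≈1 using (open-arc-G-injective)
    open InsertionSortOn totalOrder G using (sort; sort⁺; sort-AllPairs; sort-sorted; length-sort)
    open ListExtras using (All⇒AllPairs)
    sorted : List Point
    sorted = sort X
    sorted-interior : All (ArcInterior σ) sorted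
    sorted-interior = sort⁺ X-interior
    sorted-increasing : AllPairs (λ a b → G a <F G b) sorted
    sorted-increasing = AllPairs.zipWith
      (λ (((a∈A , a-arc , _) , (b∈A , b-arc , _)) , (a≤b , a≉b)) b≤a →
        a≉b (open-arc-G-injective a∈A b∈A a-arc b-arc (antisym a≤b b≤a)))
      (All⇒AllPairs sorted-interior ,
       AllPairs.zip (sort-sorted X , sort-AllPairs (λ x≉y y≈x → x≉y (≈ₚ-sym y≈x)) X-distinct))
    Z : List Point
    Z = p ∷ sorted ++ q ∷ []
    Z-on-arc : All (λ y → y ∈ₚ A × OnArc σ y) Z
    Z-on-arc = (p∈A , inj₂ (inj₁ ≈ₚ-refl))
      ∷ All.++⁺ (All.map (λ (y∈A , y-arc , _) → y∈A , inj₁ y-arc) sorted-interior)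
                ((q∈A , inj₂ (inj₂ ≈ₚ-refl)) ∷ [])
    Z-increasing : AllPairs (λ a b → G a <F G b) Z
    Z-increasing =
      All.++⁺ (All.map (λ (y∈A , _ , ¬end) y≤p → p-unique-min _ y∈A y≤p (λ y≈p → ¬end (inj₁ y≈p))) sorted-interior)
              (Gp<Gq ∷ [])
      ∷ AllPairs.++⁺ sorted-increasing ([] ∷ [])
          (All.map (λ (y∈A , _ , ¬end) → (λ q≤y → q-unique-max _ y∈A q≤y (λ y≈q → ¬end (inj₂ y≈q))) ∷ [])
                   sorted-interior)
    open ArcChain σ σ²≈1 Z Z-on-arc Z-increasing using (chain-sums; IsSum⇒ArcSum)
    length-Z : suc (suc (length X)) ≡ length Z
    length-Z = cong suc (≡.sym (≡.trans (length-++ sorted) (≡.trans (ℕ.+-comm (length sorted) 1) (cong suc (length-sort X)))))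

  record BoundarySplit (d : ℕ) : Set (c ⊔ ℓ₁ ⊔ ℓ₂) where
    field
      upper lower : List Point
      upper-interior : All (ArcInterior 1#) upper
      lower-interior : All (ArcInterior (- 1#)) lower
      upper-distinct : Distinct upper
      lower-distinct : Distinct lower
      count : 2 + (length upper + length lower) ≡ d

  split-boundary : ∀ {d} → BoundaryCount A d → ¬ ¬ BoundarySplit d
  split-boundary {d} (boundary , boundary-distinct , boundary⊆ , ⊆boundary , length-boundary) = do
    ends? ← ¬¬-decide-all boundary
    p-on ← p-on-boundary
    q-on ← q-on-boundary
    let interior = rejected ends? ; interior-distinct = rejected-AllPairs ends? boundary-distinct
    upper? ← ¬¬-decide-all interior
    let interior-props = All.zip (rejected⁺ ends? (All.tabulate (λ y∈ → boundary⊆ _ (∈⇒∈ₚ y∈))) , rejected-All ends?)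
    lower-interior ← ¬¬-sequence (All.map classify (All.zip (rejected⁺ upper? interior-props , rejected-All upper?)))
    return (record
      { upper = accepted upper?
      ; lower = rejected upper?
      ; upper-interior = All.map (λ (((y∈A , _) , ¬end) , upper) → y∈A , upper , ¬end)
                                 (All.zip (accepted⁺ upper? interior-props , accepted-All upper?))
      ; lower-interior = lower-interior
      ; upper-distinct = accepted-AllPairs upper? interior-distinct
      ; lower-distinct = rejected-AllPairs upper? interior-distinct
      ; count = ≡.trans (cong (_+ (length (accepted upper?) + length (rejected upper?))) (≡.sym (two-ends ends? p-on q-on)))
                  (≡.trans (cong (length (accepted ends?) +_) (length-accepted+rejected upper?))
                    (≡.trans (length-accepted+rejected ends?) length-boundary))
      })
    where
    open Selection
    classify : ∀ {y} → ((y ∈ₚ A × OnBoundary A y) × ¬ IsEnd y) × ¬ OnOpenArc 1# y → ¬ ¬ ArcInterior (- 1#) y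
    classify (((y∈A , y-on) , ¬end) , ¬upper) = do
      inj₂ (inj₁ lower) ← boundary-trichotomy y∈A y-on
        where inj₁ upper → contradiction upper ¬upper
              inj₂ (inj₂ end) → contradiction end ¬end
      return (y∈A , lower , ¬end)
    two-ends : (ends? : Decisions {P = IsEnd} boundary) → OnBoundary A p → OnBoundary A q → length (accepted ends?) ≡ 2
    two-ends ends? p-on q-on = ℕ.≤-antisym
      (Unique∧⊆⇒length≤ {ys = p ∷ q ∷ []} (accepted-AllPairs ends? boundary-distinct)
        (All.map (λ { (inj₁ y≈p) → here y≈p ; (inj₂ y≈q) → there (here y≈q) }) (accepted-All ends?)))
      (Unique∧⊆⇒length≤ {xs = p ∷ q ∷ []} ((p≉q ∷ []) ∷ [] ∷ [])
        (end-in ends? (⊆boundary p (p∈A , p-on)) (inj₁ ≈ₚ-refl)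
          ∷ end-in ends? (⊆boundary q (q∈A , q-on)) (inj₂ ≈ₚ-refl) ∷ []))
      where
      p≉q : ¬ (p ≈ₚ q)
      p≉q (e₁ , e₂) = w≢0 (x≈y⇒x-y≈0 (sym e₁) , x≈y⇒x-y≈0 (sym e₂))
      end-in : ∀ ends? {y} → y ∈ₚ boundary → IsEnd y → y ∈ₚ accepted {P = IsEnd} ends?
      end-in ends? y∈ end = accepted-Any ends? (Any.map (λ y≈b → y≈b , end-cong y≈b end) y∈)
        where
        end-cong : ∀ {y b} → y ≈ₚ b → IsEnd y → IsEnd b
        end-cong y≈b (inj₁ y≈p) = inj₁ (≈ₚ-trans (≈ₚ-sym y≈b) y≈p)
        end-cong y≈b (inj₂ y≈q) = inj₂ (≈ₚ-trans (≈ₚ-sym y≈b) y≈q)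

  sumset-bound : ¬ Collinear A → ∀ {s d} → SumsetSize A s → BoundaryCount A d →
    ¬ ¬ (d * d ≤ 4 * s + 2 * d * (m ∸ 1))
  sumset-bound ¬collinear {s} {d} (sumset , sumset-distinct , _ , ⊆sumset , length-sumset) boundary-count = do
    split ← split-boundary boundary-count
    let open BoundarySplit split
    (SU , SU-distinct , SU-sums , upper-bound) ← arc-sums 1# (*-identityˡ 1#) upper upper-interior upper-distinct
    (SL , SL-distinct , SL-sums , lower-bound) ← arc-sums (- 1#) -1*-1≈1 lower lower-interior lower-distinct
    SU+SL≤s+3 ← ¬¬-union-bound {ws = end-sums} SU-distinct SL-distinct
                  (All.map in-sumset SU-sums) (All.map in-sumset SL-sums) (All.map (common-sum SU-sums) SL-sums)
    return (subst₂ (λ d m → d * d ≤ 4 * s + 2 * d * (m ∸ 1))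
      (≡.trans (cong suc (ℕ.+-suc (length upper) (length lower))) count) 2+m₀≡m
      (CountingArithmetic.two-chains-bound (suc (length upper)) (suc (length lower)) m₀ s (length SU) (length SL)
        upper-bound lower-bound (subst (λ s → length SU + length SL ≤ s + 3) length-sumset SU+SL≤s+3) (s≤s z≤n)))
    where
    open SetoidPigeonhole pointSetoid using (¬¬-union-bound)
    in-sumset : ∀ {σ x} → ArcSum σ x → x ∈ₚ sumset
    in-sumset {x = x} (a , b , a∈A , b∈A , _ , _ , x≈a+b) = ⊆sumset x (a , b , a∈A , b∈A , x≈a+b)
    common-sum : ∀ {SU x} → All (ArcSum 1#) SU → ArcSum (- 1#) x → x ∈ₚ SU → ¬ ¬ (x ∈ₚ end-sums)
    common-sum SU-sums (c , e , c∈A , e∈A , c-arc , e-arc , x≈c+e) x∈SU with find x∈SU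
    ... | y , y∈SU , x≈y with All.lookup SU-sums y∈SU
    ...   | a , b , a∈A , b∈A , a-arc , b-arc , y≈a+b =
      ¬¬-map (∈ₚ-resp-≈ (≈ₚ-sym (≈ₚ-trans x≈y y≈a+b)))
        (upper-lower-common-sum a∈A b∈A c∈A e∈A a-arc b-arc c-arc e-arc
          (≈ₚ-trans (≈ₚ-sym y≈a+b) (≈ₚ-trans (≈ₚ-sym x≈y) x≈c+e)) ¬collinear)

open import Data.List using ([]; _∷_)
open import Data.Nat using (_≤_; _+_; _*_; _∸_; _≤?_)
open import Data.Product using (_,_)
open import Data.List.Relation.Unary.All using ([])
open import Relation.Nullary using (contradiction)
open import Relation.Nullary.Decidable using (decidable-stable)

lemma7p2 : ∀ {c ℓ₁ ℓ₂ : Level} (F : OrderedField c ℓ₁ ℓ₂)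
    (A : List (Plane.Point F)) → Plane.Distinct F A → ¬ Plane.Collinear F A →
    (s d m : ℕ) → Plane.SumsetSize F A s → Plane.BoundaryCount F A d →
    Plane.MaxSideSize F A m →
    d * d ≤ 4 * s + 2 * d * (m ∸ 1)
lemma7p2 F [] _ ¬collinear _ _ _ _ _ _ = contradiction (1# , 0# , 0# , (λ (1≈0 , _) → 0≉1 (sym 1≈0)) , []) ¬collinear
  where open OrderedFieldProperties F using (1#; 0#; 0≉1; sym)
lemma7p2 F (a ∷ A) A-distinct ¬collinear s d m sumset boundary max-side =
  decidable-stable (d * d ≤? 4 * s + 2 * d * (m ∸ 1))
    (ArcChains.sumset-bound F (a ∷ A) A-distinct p q (diameter-extremal D ¬collinear) m max-side
      ¬collinear sumset boundary)
  where
  open Diameters F using (diameter; diameter-extremal; module Diameter)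
  D : Diameters.Diameter F (a ∷ A)
  D = diameter a A
  open Diameter D using (p; q)
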